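{- For every integer $k\ge 0$, the exponential generating functions $A_k(z)$, $B_k(z)$, $B_{\ge k}(z)$ and $T(z)$ satisfy, for $|z|<1/2$, $$A_k'(z)=\frac{A_k(z)}{(1-T(z))^2}+B_k'(z),\qquad B_k(z)=B_{\ge k}(z)-B_{\ge k+1}(z),$$ and for every $k\ge 1$, $$B_{\ge k}'(z)=\frac{B_{\ge k-1}(z)}{1-B_{\ge k-1}(z)},\qquad B_{\ge 0}(z)=T(z).$$
   Context: A plane increasing tree on $[n]=\{1,\dots,n\}$ is a rooted tree with vertex set $[n]$ in which every non-root vertex has a larger label than its parent (so the root is $1$) and the children of each vertex form a linearly ordered set. Let $t(n)=(2n-3)!!$ denote the number of such trees ($n\ge1$, with $(-1)!!=1$), and $T(z)=\sum_{n\ge1} t(n)z^n/n! = 1-\sqrt{1-2z}$ (principal branch). The rank of a vertex $v$ is the number of edges of a shortest path from $v$ down to a leaf that is a descendant of $v$ (leaves have rank $0$). Let $a_k(n)$ be the total number of vertices of rank $k$, summed over all plane increasing trees on $[n]$, and $A_k(z)=\sum_{n\ge1}a_k(n)z^n/n!$. Let $b_k(n)$ (resp. $b_{\ge k}(n)$) be the number of plane increasing trees on $[n]$ whose root has rank exactly $k$ (resp. at least $k$), and $B_k(z)=\sum_{n\ge1}b_k(n)z^n/n!$, $B_{\ge k}(z)=\sum_{n\ge1}b_{\ge k}(n)z^n/n!$. -}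

module Defs where

open import Data.Nat using (ℕ; zero; suc; _<_; _≤_; _∸_; _≟_; _≤?_)
import Data.Nat as N
open import Data.Nat.Combinatorics using (_C_)
open import Data.Integer using (ℤ; +_; _-_) renaming (_+_ to _+ℤ_; _*_ to _*ℤ_)
open import Data.List using (List; []; _∷_; _++_; map; upTo; length; filter)
open import Data.List.Relation.Binary.Permutation.Propositional using (_↭_)
open import Data.Product using (_×_)
open import Data.Unit using (⊤)
open import Relation.Nullary.Decidable using (⌊_⌋)
open import Data.Bool using (Bool; true; false)

-- Labelled plane (ordered) rooted trees: a vertex label and the
-- linearly ordered list of subtrees of its children.

data PTree : Set where
  node : ℕ → List PTree → PTree

root : PTree → ℕ
root (node x _) = x

mutual
  labels : PTree → List ℕ
  labels (node x cs) = x ∷ labelsF cs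

  labelsF : List PTree → List ℕ
  labelsF [] = []
  labelsF (c ∷ cs) = labels c ++ labelsF cs

mutual
  Increasing : PTree → Set
  Increasing (node x cs) = IncreasingF x cs

  IncreasingF : ℕ → List PTree → Set
  IncreasingF x [] = ⊤
  IncreasingF x (c ∷ cs) = (x < root c) × Increasing c × IncreasingF x cs

-- t is a plane increasing tree on [n] = {1,…,n}:
-- vertex set is exactly [n] (each label used once) and labels increase.
IsPIT : ℕ → PTree → Set
IsPIT n t = (labels t ↭ map suc (upTo n)) × Increasing t

mutual
  rank : PTree → ℕ
  rank (node _ []) = 0
  rank (node _ (c ∷ cs)) = suc (minRank (rank c) cs)

  minRank : ℕ → List PTree → ℕ
  minRank m [] = m
  minRank m (c ∷ cs) = minRank (m N.⊓ rank c) cs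

ind : Bool → ℕ
ind true = 1
ind false = 0

mutual
  countRank : ℕ → PTree → ℕ
  countRank k (node x cs) = ind ⌊ rank (node x cs) ≟ k ⌋ N.+ countRankF k cs

  countRankF : ℕ → List PTree → ℕ
  countRankF k [] = 0
  countRankF k (c ∷ cs) = countRank k c N.+ countRankF k cs

sumL : List ℕ → ℕ
sumL [] = 0
sumL (x ∷ xs) = x N.+ sumL xs

-- Exponential generating functions, represented by their coefficient
-- sequences: F(z) = Σ_n f n z^n / n!, with f : ℕ → ℤ.
-- All identities are identities of formal power series
-- (coefficientwise equality).

Series : Set
Series = ℕ → ℤ

sumTo : ℕ → (ℕ → ℤ) → ℤ
sumTo zero f = f 0
sumTo (suc n) f = sumTo n f +ℤ f (suc n)

-- derivative F'(z): n!-coefficients shift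
D : Series → Series
D f n = f (suc n)

_⋆_ : Series → Series → Series
(f ⋆ g) n = sumTo n (λ i → + (n C i) *ℤ f i *ℤ g (n ∸ i))

oneS : Series
oneS zero = + 1
oneS (suc _) = + 0

powS : Series → ℕ → Series
powS f zero = oneS
powS f (suc j) = f ⋆ powS f j

-- 1/(1 - F(z)) = Σ_j F(z)^j, for F with F(0) = 0
-- (then F^j has no terms of degree < j, so the coefficient of degree n
-- only receives contributions from j ≤ n).
inv1m : Series → Series
inv1m f n = sumTo n (λ j → powS f j n)

-- The sequences of the paper, given a duplicate-free list enum n of all
-- plane increasing trees on [n].

-- (2m-1)!!, with (-1)!! = 1
oddFact : ℕ → ℕ
oddFact zero = 1
oddFact (suc m) = suc (2 N.* m) N.* oddFact m

-- t(n) = (2n-3)!! for n ≥ 1; the series T has no constant term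
tS : Series
tS zero = + 0
tS (suc m) = + oddFact m

module Counts (enum : ℕ → List PTree) where

  -- a_k(n), n ≥ 1 (coefficient 0 is 0: the EGF sum starts at n = 1)
  aS : ℕ → Series
  aS k zero = + 0
  aS k (suc m) = + sumL (map (countRank k) (enum (suc m)))

  bS : ℕ → Series
  bS k zero = + 0
  bS k (suc m) = + length (filter (λ t → rank t ≟ k) (enum (suc m)))

  bgeS : ℕ → Series
  bgeS k zero = + 0
  bgeS k (suc m) = + length (filter (λ t → k ≤? rank t) (enum (suc m)))

{-# OPTIONS --safe #-}
module Submission where

-- Each count in the statement sums, over the plane increasing trees on [n], a weight that ignores
-- labels, so it can be computed on an explicit enumeration of the increasing forests on any sorted
-- list of n labels (the given enumeration is a permutation of it, being sound, complete and free of
-- duplicates). The enumeration splits a forest into its first tree and the rest, which turns sums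
-- over forests into binomial convolutions of sums over trees; in particular a forest weight that is
-- a product of tree weights w has series 1 / (1 - T_w). With w = 1 this gives T′ = 1 / (1 - T),
-- which forces t(n) = (2n - 3)!!. A root has rank ≥ k + 1 iff it has children, all of rank ≥ k,
-- which gives B′_{≥k+1} = B_{≥k} / (1 - B_{≥k}). The vertices of rank k of a tree are its root, if
-- it has rank k, and those of its subtrees; the forest sum F of the latter satisfies
-- F = A_k / (1 - T) + T F, so F = A_k / (1 - T)², and A_k′ = B_k′ + F.

open import Defs
open import Data.Nat as N using (ℕ; zero; suc; _≤_; _<_; _∸_; z≤n; s≤s; _≟_; _≤?_)
import Data.Nat.Properties as NP
open import Data.Nat.Combinatorics using (_C_; nC1≡n; nCk+nC[k+1]≡[n+1]C[k+1])
open import Data.Nat.Combinatorics.Specification using (k>n⇒nCk≡0)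
open import Data.Nat.Induction using (<-rec)
open import Data.Nat.ListAction using (sum)
open import Data.Nat.ListAction.Properties using (sum-↭)
import Data.Nat.Tactic.RingSolver as NatSolver
open import Data.Integer using (ℤ; +_; _+_; _-_; _*_; -_; 0ℤ)
import Data.Integer.Properties as ZP
open import Data.Integer.Tactic.RingSolver using (solve-∀)
open import Algebra.Properties.CommutativeSemigroup NP.+-commutativeSemigroup using () renaming (interchange to ℕ-interchange)
open import Algebra.Properties.CommutativeSemigroup ZP.+-commutativeSemigroup using (x∙yz≈y∙xz) renaming (interchange to ℤ-interchange)
open import Data.Empty using (⊥-elim)
open import Data.Unit using (tt)
open import Data.Product as Prod using (_×_; _,_; proj₁; proj₂; ∃)
open import Data.Sum using (_⊎_; inj₁; inj₂; [_,_]′)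
open import Data.List using (List; []; _∷_; _++_; map; concat; concatMap; cartesianProductWith; filter; length; replicate; upTo)
import Data.List.Properties as LP
open import Data.List.Membership.Propositional using (_∈_; _∉_; find; lose)
open import Data.List.Membership.Propositional.Properties using (∈-map⁻; ∈-map⁺; ∈-++⁻; ∈-++⁺ˡ; ∈-++⁺ʳ; ∈-filter⁻; ∈-filter⁺; ∈-concatMap⁻; ∈-concatMap⁺; ∈-cartesianProductWith⁻; ∈-cartesianProductWith⁺)
open import Data.List.Membership.Propositional.Properties.WithK using (unique∧set⇒bag)
open import Data.List.Membership.DecPropositional N._≟_ using (_∈?_)
open import Data.List.Relation.Unary.Any using (here; there)
open import Data.List.Relation.Unary.All as All using (All; []; _∷_)
import Data.List.Relation.Unary.All.Properties as AllP
open import Data.List.Relation.Unary.AllPairs as AllPairs using (AllPairs; []; _∷_)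
import Data.List.Relation.Unary.AllPairs.Properties as AllPairsP
open import Data.List.Relation.Unary.Unique.Propositional using (Unique)
import Data.List.Relation.Unary.Unique.Propositional.Properties as UP
open import Data.List.Relation.Binary.Permutation.Propositional using (_↭_; ↭-refl; ↭-sym; ↭-prep; ↭-trans; ↭⇒↭ₛ)
import Data.List.Relation.Binary.Permutation.Propositional.Properties as PermP
import Data.List.Relation.Binary.Permutation.Setoid.Properties as PermS
open import Data.List.Relation.Binary.BagAndSetEquality using (∼bag⇒↭)
open import Function using (_∘_; id)
open import Function.Bundles using (_⇔_; mk⇔; Equivalence)
open import Relation.Nullary using (¬_; Dec; yes; no)
open import Relation.Nullary.Decidable using (¬?; ⌊_⌋)
open import Relation.Unary using (Decidable)
open import Relation.Binary.PropositionalEquality using (_≡_; _≗_; refl; sym; trans; cong; cong₂; subst; setoid; module ≡-Reasoning)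
open ≡-Reasoning

-- Exponential generating functions

sumTo-cong-≤ : ∀ n {f g : ℕ → ℤ} → (∀ i → i ≤ n → f i ≡ g i) → sumTo n f ≡ sumTo n g
sumTo-cong-≤ zero f≗g = f≗g 0 z≤n
sumTo-cong-≤ (suc n) f≗g =
  cong₂ _+_ (sumTo-cong-≤ n (λ i i≤n → f≗g i (NP.m≤n⇒m≤1+n i≤n))) (f≗g (suc n) NP.≤-refl)

sumTo-cong : ∀ n {f g : ℕ → ℤ} → f ≗ g → sumTo n f ≡ sumTo n g
sumTo-cong n f≗g = sumTo-cong-≤ n (λ i _ → f≗g i)

sumTo-zero : ∀ n {f : ℕ → ℤ} → (∀ i → i ≤ n → f i ≡ 0ℤ) → sumTo n f ≡ 0ℤ
sumTo-zero zero f≡0 = f≡0 0 z≤n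
sumTo-zero (suc n) f≡0 =
  cong₂ _+_ (sumTo-zero n (λ i i≤n → f≡0 i (NP.m≤n⇒m≤1+n i≤n))) (f≡0 (suc n) NP.≤-refl)

sumTo-+ : ∀ n (f g : ℕ → ℤ) → sumTo n (λ i → f i + g i) ≡ sumTo n f + sumTo n g
sumTo-+ zero f g = refl
sumTo-+ (suc n) f g =
  trans (cong (_+ (f (suc n) + g (suc n))) (sumTo-+ n f g)) (ℤ-interchange (sumTo n f) (sumTo n g) (f (suc n)) (g (suc n)))

*-distribˡ-sumTo : ∀ n c (f : ℕ → ℤ) → c * sumTo n f ≡ sumTo n (λ i → c * f i)
*-distribˡ-sumTo zero c f = refl
*-distribˡ-sumTo (suc n) c f =
  trans (ZP.*-distribˡ-+ c (sumTo n f) (f (suc n))) (cong (_+ c * f (suc n)) (*-distribˡ-sumTo n c f))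

sumTo-unfoldˡ : ∀ n (f : ℕ → ℤ) → sumTo (suc n) f ≡ f 0 + sumTo n (λ i → f (suc i))
sumTo-unfoldˡ zero f = refl
sumTo-unfoldˡ (suc n) f = trans (cong (_+ f (suc (suc n))) (sumTo-unfoldˡ n f)) (ZP.+-assoc (f 0) _ _)

sumTo-comm : ∀ n m (h : ℕ → ℕ → ℤ) →
  sumTo n (λ i → sumTo m (h i)) ≡ sumTo m (λ j → sumTo n (λ i → h i j))
sumTo-comm zero m h = refl
sumTo-comm (suc n) m h = begin
  sumTo n (λ i → sumTo m (h i)) + sumTo m (h (suc n))
    ≡⟨ cong (_+ sumTo m (h (suc n))) (sumTo-comm n m h) ⟩
  sumTo m (λ j → sumTo n (λ i → h i j)) + sumTo m (h (suc n))
    ≡⟨ sumTo-+ m (λ j → sumTo n (λ i → h i j)) (h (suc n)) ⟨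
  sumTo m (λ j → sumTo n (λ i → h i j) + h (suc n) j) ∎

sumTo-extend : ∀ k m (f : ℕ → ℤ) → k ≤ m → (∀ j → k < j → j ≤ m → f j ≡ 0ℤ) → sumTo m f ≡ sumTo k f
sumTo-extend k zero f z≤n _ = refl
sumTo-extend k (suc m) f k≤1+m f≡0 with NP.m≤n⇒m<n∨m≡n k≤1+m
... | inj₂ refl = refl
... | inj₁ (s≤s k≤m) = begin
  sumTo m f + f (suc m)
    ≡⟨ cong₂ _+_ (sumTo-extend k m f k≤m (λ j k<j j≤m → f≡0 j k<j (NP.m≤n⇒m≤1+n j≤m)))
                 (f≡0 (suc m) (s≤s k≤m) NP.≤-refl) ⟩
  sumTo k f + 0ℤ
    ≡⟨ ZP.+-identityʳ _ ⟩
  sumTo k f ∎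

neg-distrib-sumTo : ∀ n (f : ℕ → ℤ) → - sumTo n f ≡ sumTo n (λ i → - f i)
neg-distrib-sumTo zero f = refl
neg-distrib-sumTo (suc n) f =
  trans (ZP.neg-distrib-+ (sumTo n f) (f (suc n))) (cong (_+ - f (suc n)) (neg-distrib-sumTo n f))

binomialSum : ℕ → (ℕ → ℕ → ℤ) → ℤ
binomialSum n F = sumTo n (λ i → + (n C i) * F i (n ∸ i))

binomialSum-cong : ∀ n {F G : ℕ → ℕ → ℤ} → (∀ i j → F i j ≡ G i j) → binomialSum n F ≡ binomialSum n G
binomialSum-cong n F≗G = sumTo-cong n (λ i → cong (+ (n C i) *_) (F≗G i (n ∸ i)))

binomialSum-+ : ∀ n F G → binomialSum n (λ i j → F i j + G i j) ≡ binomialSum n F + binomialSum n G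
binomialSum-+ n F G =
  trans (sumTo-cong n (λ i → ZP.*-distribˡ-+ (+ (n C i)) (F i (n ∸ i)) (G i (n ∸ i)))) (sumTo-+ n _ _)

-- Pascal's rule, summed.
binomialSum-suc : ∀ n F →
  binomialSum (suc n) F ≡ binomialSum n (λ i j → F (suc i) j) + binomialSum n (λ i j → F i (suc j))
binomialSum-suc n F = begin
  binomialSum (suc n) F
    ≡⟨ sumTo-unfoldˡ n t ⟩
  t 0 + sumTo n (λ i → t (suc i))
    ≡⟨ cong (λ z → t 0 + z) (trans (sumTo-cong n t-suc) (sumTo-+ n left right)) ⟩
  t 0 + (sumTo n left + sumTo n right)
    ≡⟨ x∙yz≈y∙xz (t 0) (sumTo n left) (sumTo n right) ⟩
  sumTo n left + (t 0 + sumTo n right)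
    ≡⟨ cong (λ z → sumTo n left + z) rightShifted ⟩
  sumTo n left + binomialSum n (λ i j → F i (suc j)) ∎
  where
  t left right shifted : ℕ → ℤ
  t i = + (suc n C i) * F i (suc n ∸ i)
  left i = + (n C i) * F (suc i) (n ∸ i)
  right i = + (n C suc i) * F (suc i) (n ∸ i)
  shifted i = + (n C i) * F i (suc n ∸ i)
  t-suc : ∀ i → t (suc i) ≡ left i + right i
  t-suc i = begin
    + (suc n C suc i) * F (suc i) (n ∸ i)
      ≡⟨ cong (λ c → + c * F (suc i) (n ∸ i)) (nCk+nC[k+1]≡[n+1]C[k+1] n i) ⟨
    + (n C i N.+ n C suc i) * F (suc i) (n ∸ i)
      ≡⟨ cong (_* F (suc i) (n ∸ i)) (ZP.pos-+ (n C i) (n C suc i)) ⟩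
    (+ (n C i) + + (n C suc i)) * F (suc i) (n ∸ i)
      ≡⟨ ZP.*-distribʳ-+ (F (suc i) (n ∸ i)) (+ (n C i)) (+ (n C suc i)) ⟩
    left i + right i ∎
  rightShifted : t 0 + sumTo n right ≡ binomialSum n (λ i j → F i (suc j))
  rightShifted = begin
    shifted 0 + sumTo n (λ i → shifted (suc i))
      ≡⟨ sumTo-unfoldˡ n shifted ⟨
    sumTo n shifted + shifted (suc n)
      ≡⟨ cong (λ c → sumTo n shifted + + c * F (suc n) (n ∸ n)) (k>n⇒nCk≡0 (NP.n<1+n n)) ⟩
    sumTo n shifted + 0ℤ * F (suc n) (n ∸ n)
      ≡⟨ cong (λ z → sumTo n shifted + z) (ZP.*-zeroˡ (F (suc n) (n ∸ n))) ⟩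
    sumTo n shifted + 0ℤ
      ≡⟨ ZP.+-identityʳ _ ⟩
    sumTo n shifted
      ≡⟨ sumTo-cong-≤ n (λ i i≤n → cong (λ m → + (n C i) * F i m) (NP.+-∸-assoc 1 i≤n)) ⟩
    binomialSum n (λ i j → F i (suc j)) ∎

_⊕_ : Series → Series → Series
(f ⊕ g) n = f n + g n

infixl 6 _⊕_

negS : Series → Series
negS f n = - f n

zeroS : Series
zeroS _ = 0ℤ

⋆-as-binomialSum : ∀ f g n → (f ⋆ g) n ≡ binomialSum n (λ i j → f i * g j)
⋆-as-binomialSum f g n = sumTo-cong n (λ i → ZP.*-assoc (+ (n C i)) (f i) (g (n ∸ i)))

⋆-at-0 : ∀ f g → (f ⋆ g) 0 ≡ f 0 * g 0
⋆-at-0 f g = trans (⋆-as-binomialSum f g 0) (ZP.*-identityˡ (f 0 * g 0))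

D-⋆ : ∀ f g → D (f ⋆ g) ≗ D f ⋆ g ⊕ f ⋆ D g
D-⋆ f g n = begin
  (f ⋆ g) (suc n)
    ≡⟨ ⋆-as-binomialSum f g (suc n) ⟩
  binomialSum (suc n) (λ i j → f i * g j)
    ≡⟨ binomialSum-suc n (λ i j → f i * g j) ⟩
  binomialSum n (λ i j → f (suc i) * g j) + binomialSum n (λ i j → f i * g (suc j))
    ≡⟨ cong₂ _+_ (⋆-as-binomialSum (D f) g n) (⋆-as-binomialSum f (D g) n) ⟨
  (D f ⋆ g) n + (f ⋆ D g) n ∎

⋆-cong-≤ : ∀ n {f f′ g g′ : Series} → (∀ i → i ≤ n → f i ≡ f′ i) → (∀ i → i ≤ n → g i ≡ g′ i) →
  (f ⋆ g) n ≡ (f′ ⋆ g′) n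
⋆-cong-≤ n f≗f′ g≗g′ = sumTo-cong-≤ n (λ i i≤n →
  cong₂ (λ x y → + (n C i) * x * y) (f≗f′ i i≤n) (g≗g′ (n ∸ i) (NP.m∸n≤m n i)))

⋆-cong : ∀ {f f′ g g′ : Series} → f ≗ f′ → g ≗ g′ → f ⋆ g ≗ f′ ⋆ g′
⋆-cong f≗f′ g≗g′ n = ⋆-cong-≤ n (λ i _ → f≗f′ i) (λ i _ → g≗g′ i)

⋆-congˡ : ∀ f {g g′} → g ≗ g′ → f ⋆ g ≗ f ⋆ g′
⋆-congˡ f = ⋆-cong {f = f} (λ _ → refl)

⋆-congʳ : ∀ {f f′} g → f ≗ f′ → f ⋆ g ≗ f′ ⋆ g
⋆-congʳ g f≗f′ = ⋆-cong {g = g} f≗f′ (λ _ → refl)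

⋆-distribˡ-⊕ : ∀ f g h → f ⋆ (g ⊕ h) ≗ f ⋆ g ⊕ f ⋆ h
⋆-distribˡ-⊕ f g h n = trans (sumTo-cong n (λ i → distrib (+ (n C i)) (f i) (g (n ∸ i)) (h (n ∸ i)))) (sumTo-+ n _ _)
  where
  distrib : ∀ c x y z → c * x * (y + z) ≡ c * x * y + c * x * z
  distrib = solve-∀

⋆-distribʳ-⊕ : ∀ f g h → (f ⊕ g) ⋆ h ≗ f ⋆ h ⊕ g ⋆ h
⋆-distribʳ-⊕ f g h n = trans (sumTo-cong n (λ i → distrib (+ (n C i)) (f i) (g i) (h (n ∸ i)))) (sumTo-+ n _ _)
  where
  distrib : ∀ c x y z → c * (x + y) * z ≡ c * x * z + c * y * z
  distrib = solve-∀

negS-⋆ : ∀ f g → negS f ⋆ g ≗ negS (f ⋆ g)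
negS-⋆ f g n = trans (sumTo-cong n (λ i → pull (+ (n C i)) (f i) (g (n ∸ i)))) (sym (neg-distrib-sumTo n _))
  where
  pull : ∀ c x y → c * (- x) * y ≡ - (c * x * y)
  pull = solve-∀

⋆-zeroˡ : ∀ g → zeroS ⋆ g ≗ zeroS
⋆-zeroˡ g n = sumTo-zero n (λ i _ →
  trans (cong (_* g (n ∸ i)) (ZP.*-zeroʳ (+ (n C i)))) (ZP.*-zeroˡ (g (n ∸ i))))

-- A coefficient of f ⋆ g is determined by the constant terms and, through the Leibniz rule D-⋆,
-- by lower coefficients; so the ring laws follow by induction on the degree.
⋆-comm : ∀ f g → f ⋆ g ≗ g ⋆ f
⋆-comm f g zero = trans (⋆-at-0 f g) (trans (ZP.*-comm (f 0) (g 0)) (sym (⋆-at-0 g f)))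
⋆-comm f g (suc n) = begin
  D (f ⋆ g) n                  ≡⟨ D-⋆ f g n ⟩
  (D f ⋆ g) n + (f ⋆ D g) n    ≡⟨ cong₂ _+_ (⋆-comm (D f) g n) (⋆-comm f (D g) n) ⟩
  (g ⋆ D f) n + (D g ⋆ f) n    ≡⟨ ZP.+-comm ((g ⋆ D f) n) ((D g ⋆ f) n) ⟩
  (D g ⋆ f) n + (g ⋆ D f) n    ≡⟨ D-⋆ g f n ⟨
  D (g ⋆ f) n                  ∎

⋆-identityˡ : ∀ g → oneS ⋆ g ≗ g
⋆-identityˡ g zero = trans (⋆-at-0 oneS g) (ZP.*-identityˡ (g 0))
⋆-identityˡ g (suc n) = begin
  D (oneS ⋆ g) n                    ≡⟨ D-⋆ oneS g n ⟩
  (D oneS ⋆ g) n + (oneS ⋆ D g) n   ≡⟨ cong₂ _+_ (⋆-zeroˡ g n) (⋆-identityˡ (D g) n) ⟩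
  0ℤ + g (suc n)                    ≡⟨ ZP.+-identityˡ _ ⟩
  g (suc n)                         ∎

⋆-assoc : ∀ f g h → (f ⋆ g) ⋆ h ≗ f ⋆ (g ⋆ h)
⋆-assoc f g h zero = begin
  ((f ⋆ g) ⋆ h) 0       ≡⟨ ⋆-at-0 (f ⋆ g) h ⟩
  (f ⋆ g) 0 * h 0       ≡⟨ cong (_* h 0) (⋆-at-0 f g) ⟩
  f 0 * g 0 * h 0       ≡⟨ ZP.*-assoc (f 0) (g 0) (h 0) ⟩
  f 0 * (g 0 * h 0)     ≡⟨ cong (f 0 *_) (⋆-at-0 g h) ⟨
  f 0 * (g ⋆ h) 0       ≡⟨ ⋆-at-0 f (g ⋆ h) ⟨
  (f ⋆ (g ⋆ h)) 0       ∎
⋆-assoc f g h (suc n) = begin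
  D ((f ⋆ g) ⋆ h) n
    ≡⟨ D-⋆ (f ⋆ g) h n ⟩
  (D (f ⋆ g) ⋆ h) n + ((f ⋆ g) ⋆ D h) n
    ≡⟨ cong (_+ ((f ⋆ g) ⋆ D h) n) (trans (⋆-congʳ h (D-⋆ f g) n) (⋆-distribʳ-⊕ (D f ⋆ g) (f ⋆ D g) h n)) ⟩
  ((D f ⋆ g) ⋆ h) n + ((f ⋆ D g) ⋆ h) n + ((f ⋆ g) ⋆ D h) n
    ≡⟨ cong₂ _+_ (cong₂ _+_ (⋆-assoc (D f) g h n) (⋆-assoc f (D g) h n)) (⋆-assoc f g (D h) n) ⟩
  (D f ⋆ (g ⋆ h)) n + (f ⋆ (D g ⋆ h)) n + (f ⋆ (g ⋆ D h)) n
    ≡⟨ ZP.+-assoc ((D f ⋆ (g ⋆ h)) n) ((f ⋆ (D g ⋆ h)) n) ((f ⋆ (g ⋆ D h)) n) ⟩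
  (D f ⋆ (g ⋆ h)) n + ((f ⋆ (D g ⋆ h)) n + (f ⋆ (g ⋆ D h)) n)
    ≡⟨ cong (λ z → (D f ⋆ (g ⋆ h)) n + z)
            (trans (sym (⋆-distribˡ-⊕ f (D g ⋆ h) (g ⋆ D h) n)) (⋆-congˡ f (λ m → sym (D-⋆ g h m)) n)) ⟩
  (D f ⋆ (g ⋆ h)) n + (f ⋆ D (g ⋆ h)) n
    ≡⟨ D-⋆ f (g ⋆ h) n ⟨
  D (f ⋆ (g ⋆ h)) n ∎

⋆-cong-below : ∀ n g {X Y} → g 0 ≡ 0ℤ → (∀ {m} → m < n → X m ≡ Y m) → (g ⋆ X) n ≡ (g ⋆ Y) n
⋆-cong-below n g {X} {Y} g0≡0 X≡Y = sumTo-cong-≤ n term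
  where
  term : ∀ i → i ≤ n → + (n C i) * g i * X (n ∸ i) ≡ + (n C i) * g i * Y (n ∸ i)
  term zero _ rewrite g0≡0 = refl
  term (suc i) 1+i≤n = cong (+ (n C suc i) * g (suc i) *_) (X≡Y (NP.∸-monoʳ-< (s≤s z≤n) 1+i≤n))

⋆-fixpoint-unique : ∀ g c {X Y} → g 0 ≡ 0ℤ → X ≗ c ⊕ g ⋆ X → Y ≗ c ⊕ g ⋆ Y → X ≗ Y
⋆-fixpoint-unique g c {X} {Y} g0≡0 X-eq Y-eq = <-rec (λ n → X n ≡ Y n) step
  where
  step : ∀ n → (∀ {m} → m < n → X m ≡ Y m) → X n ≡ Y n
  step n X≡Y-below =
    trans (X-eq n) (trans (cong (λ z → c n + z) (⋆-cong-below n g g0≡0 X≡Y-below)) (sym (Y-eq n)))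

powS-vanishes : ∀ g → g 0 ≡ 0ℤ → ∀ j n → n < j → powS g j n ≡ 0ℤ
powS-vanishes g g0≡0 (suc j) n (s≤s n≤j) = begin
  (g ⋆ powS g j) n   ≡⟨ ⋆-cong-below n g g0≡0 (λ m<n → powS-vanishes g g0≡0 j _ (NP.<-≤-trans m<n n≤j)) ⟩
  (g ⋆ zeroS) n      ≡⟨ ⋆-comm g zeroS n ⟩
  (zeroS ⋆ g) n      ≡⟨ ⋆-zeroˡ g n ⟩
  0ℤ                 ∎

powS-cong : ∀ {g g′} → g ≗ g′ → ∀ j → powS g j ≗ powS g′ j
powS-cong g≗g′ zero = λ _ → refl
powS-cong g≗g′ (suc j) = ⋆-cong g≗g′ (powS-cong g≗g′ j)

inv1m-cong : ∀ {g g′} → g ≗ g′ → inv1m g ≗ inv1m g′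
inv1m-cong g≗g′ n = sumTo-cong n (λ j → powS-cong g≗g′ j n)

inv1m-fixpoint : ∀ g → g 0 ≡ 0ℤ → inv1m g ≗ oneS ⊕ g ⋆ inv1m g
inv1m-fixpoint g g0≡0 zero = begin
  + 1                         ≡⟨ ZP.+-identityʳ (+ 1) ⟨
  + 1 + 0ℤ                    ≡⟨ cong (λ z → + 1 + z) (ZP.*-zeroˡ (inv1m g 0)) ⟨
  + 1 + 0ℤ * inv1m g 0        ≡⟨ cong (λ z → + 1 + z * inv1m g 0) g0≡0 ⟨
  + 1 + g 0 * inv1m g 0       ≡⟨ cong (λ z → + 1 + z) (⋆-at-0 g (inv1m g)) ⟨
  + 1 + (g ⋆ inv1m g) 0       ∎
inv1m-fixpoint g g0≡0 (suc m) = begin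
  inv1m g (suc m)
    ≡⟨ sumTo-unfoldˡ m (λ j → powS g j (suc m)) ⟩
  0ℤ + sumTo m (λ j → sumTo (suc m) (λ i → term i j))
    ≡⟨ cong (λ z → 0ℤ + z) (sumTo-comm (suc m) m term) ⟨
  0ℤ + sumTo (suc m) (λ i → sumTo m (term i))
    ≡⟨ cong (λ z → 0ℤ + z) (sumTo-cong-≤ (suc m) collect) ⟩
  0ℤ + (g ⋆ inv1m g) (suc m) ∎
  where
  term : ℕ → ℕ → ℤ
  term i j = + (suc m C i) * g i * powS g j (suc m ∸ i)
  collect : ∀ i → i ≤ suc m → sumTo m (term i) ≡ + (suc m C i) * g i * inv1m g (suc m ∸ i)
  collect zero _ rewrite g0≡0 = sumTo-zero m (λ _ _ → refl)
  collect (suc i) (s≤s i≤m) = begin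
    sumTo m (λ j → c * powS g j (m ∸ i))
      ≡⟨ *-distribˡ-sumTo m c (λ j → powS g j (m ∸ i)) ⟨
    c * sumTo m (λ j → powS g j (m ∸ i))
      ≡⟨ cong (c *_) (sumTo-extend (m ∸ i) m (λ j → powS g j (m ∸ i)) (NP.m∸n≤m m i)
                       (λ j m∸i<j _ → powS-vanishes g g0≡0 j (m ∸ i) m∸i<j)) ⟩
    c * inv1m g (m ∸ i) ∎
    where
    c : ℤ
    c = + (suc m C suc i) * g (suc i)

⋆-fixpoint-inv1m² : ∀ a g {X} → g 0 ≡ 0ℤ → X ≗ a ⋆ inv1m g ⊕ g ⋆ X → X ≗ a ⋆ (inv1m g ⋆ inv1m g)
⋆-fixpoint-inv1m² a g {X} g0≡0 X-eq = ⋆-fixpoint-unique g (a ⋆ I) g0≡0 X-eq Y-eq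
  where
  I : Series
  I = inv1m g
  I²-eq : I ⋆ I ≗ I ⊕ g ⋆ (I ⋆ I)
  I²-eq n = begin
    (I ⋆ I) n                     ≡⟨ ⋆-congʳ I (inv1m-fixpoint g g0≡0) n ⟩
    ((oneS ⊕ g ⋆ I) ⋆ I) n        ≡⟨ ⋆-distribʳ-⊕ oneS (g ⋆ I) I n ⟩
    (oneS ⋆ I) n + ((g ⋆ I) ⋆ I) n ≡⟨ cong₂ _+_ (⋆-identityˡ I n) (⋆-assoc g I I n) ⟩
    I n + (g ⋆ (I ⋆ I)) n          ∎
  Y-eq : a ⋆ (I ⋆ I) ≗ a ⋆ I ⊕ g ⋆ (a ⋆ (I ⋆ I))
  Y-eq n = begin
    (a ⋆ (I ⋆ I)) n                          ≡⟨ ⋆-congˡ a I²-eq n ⟩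
    (a ⋆ (I ⊕ g ⋆ (I ⋆ I))) n                ≡⟨ ⋆-distribˡ-⊕ a I (g ⋆ (I ⋆ I)) n ⟩
    (a ⋆ I) n + (a ⋆ (g ⋆ (I ⋆ I))) n        ≡⟨ cong (λ z → (a ⋆ I) n + z) (regroup n) ⟩
    (a ⋆ I) n + (g ⋆ (a ⋆ (I ⋆ I))) n        ∎
    where
    regroup : a ⋆ (g ⋆ (I ⋆ I)) ≗ g ⋆ (a ⋆ (I ⋆ I))
    regroup m = begin
      (a ⋆ (g ⋆ (I ⋆ I))) m   ≡⟨ ⋆-assoc a g (I ⋆ I) m ⟨
      ((a ⋆ g) ⋆ (I ⋆ I)) m   ≡⟨ ⋆-congʳ (I ⋆ I) (⋆-comm a g) m ⟩
      ((g ⋆ a) ⋆ (I ⋆ I)) m   ≡⟨ ⋆-assoc g a (I ⋆ I) m ⟩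
      (g ⋆ (a ⋆ (I ⋆ I))) m   ∎

-- With v = 1 - u the equation says v u′ = 1, hence (v²)′ = -2 v u′ = -2 and v² = 1 - 2z.
-- Differentiating the equation gives v u″ = u′², hence (1 - 2z) u″ = v u′ u′ = u′: this is the
-- recurrence u_{n+1} = (2n - 1) u_n of the numbers (2n - 3)!!.
module TreeEquation (u : Series) (u0≡0 : u 0 ≡ 0ℤ) (u-eq : D u ≗ oneS ⊕ u ⋆ D u) where

  private
    v p : Series
    v = oneS ⊕ negS u
    p = D u

    cancel : ∀ a b → a + b - b ≡ a
    cancel = solve-∀

    v-⋆ : ∀ f n → (v ⋆ f) n ≡ f n - (u ⋆ f) n
    v-⋆ f n = trans (⋆-distribʳ-⊕ oneS (negS u) f n) (cong₂ _+_ (⋆-identityˡ f n) (negS-⋆ u f n))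

  v-⋆-p : v ⋆ p ≗ oneS
  v-⋆-p n = begin
    (v ⋆ p) n                        ≡⟨ v-⋆ p n ⟩
    p n - (u ⋆ p) n                  ≡⟨ cong (_- (u ⋆ p) n) (u-eq n) ⟩
    oneS n + (u ⋆ p) n - (u ⋆ p) n   ≡⟨ cancel (oneS n) ((u ⋆ p) n) ⟩
    oneS n                           ∎

  D-v : D v ≗ negS p
  D-v n = ZP.+-identityˡ (- p n)

  D-v² : ∀ n → D (v ⋆ v) n ≡ - oneS n + - oneS n
  D-v² n = begin
    D (v ⋆ v) n                      ≡⟨ D-⋆ v v n ⟩
    (D v ⋆ v) n + (v ⋆ D v) n        ≡⟨ cong₂ _+_ (⋆-congʳ v D-v n) (⋆-congˡ v D-v n) ⟩
    (negS p ⋆ v) n + (v ⋆ negS p) n  ≡⟨ cong (λ z → (negS p ⋆ v) n + z) (⋆-comm v (negS p) n) ⟩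
    (negS p ⋆ v) n + (negS p ⋆ v) n  ≡⟨ cong₂ _+_ (negS-⋆ p v n) (negS-⋆ p v n) ⟩
    - (p ⋆ v) n + - (p ⋆ v) n        ≡⟨ cong (λ z → - z + - z) (trans (⋆-comm p v n) (v-⋆-p n)) ⟩
    - oneS n + - oneS n              ∎

  v²-at-0 : (v ⋆ v) 0 ≡ + 1
  v²-at-0 = trans (⋆-at-0 v v) (cong (λ z → (+ 1 + - z) * (+ 1 + - z)) u0≡0)

  D-p : D p ≗ p ⋆ p ⊕ u ⋆ D p
  D-p n = trans (u-eq (suc n)) (trans (ZP.+-identityˡ _) (D-⋆ u p n))

  v-⋆-D-p : v ⋆ D p ≗ p ⋆ p
  v-⋆-D-p n = begin
    (v ⋆ D p) n                                ≡⟨ v-⋆ (D p) n ⟩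
    D p n - (u ⋆ D p) n                        ≡⟨ cong (_- (u ⋆ D p) n) (D-p n) ⟩
    (p ⋆ p) n + (u ⋆ D p) n - (u ⋆ D p) n      ≡⟨ cancel ((p ⋆ p) n) ((u ⋆ D p) n) ⟩
    (p ⋆ p) n                                  ∎

  v²-⋆-D-p : (v ⋆ v) ⋆ D p ≗ p
  v²-⋆-D-p n = begin
    ((v ⋆ v) ⋆ D p) n   ≡⟨ ⋆-assoc v v (D p) n ⟩
    (v ⋆ (v ⋆ D p)) n   ≡⟨ ⋆-congˡ v v-⋆-D-p n ⟩
    (v ⋆ (p ⋆ p)) n     ≡⟨ ⋆-assoc v p p n ⟨
    ((v ⋆ p) ⋆ p) n     ≡⟨ ⋆-congʳ p v-⋆-p n ⟩
    (oneS ⋆ p) n        ≡⟨ ⋆-identityˡ p n ⟩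
    p n                 ∎

  v²-⋆-D-p-at-suc : ∀ n → ((v ⋆ v) ⋆ D p) (suc n) ≡ D p (suc n) + + suc n * (- + 2 * D p n)
  v²-⋆-D-p-at-suc n = begin
    ((v ⋆ v) ⋆ D p) (suc n)
      ≡⟨ sumTo-unfoldˡ n t ⟩
    t 0 + sumTo n (λ i → t (suc i))
      ≡⟨ cong (λ z → t 0 + z) (sumTo-extend 0 n (λ i → t (suc i)) z≤n (λ { (suc i) _ _ → higher i })) ⟩
    t 0 + t 1
      ≡⟨ cong₂ _+_ (trans (cong (λ z → + 1 * z * D p (suc n)) v²-at-0) (ZP.*-identityˡ _))
                   (trans (cong₂ (λ c z → + c * z * D p n) (nC1≡n (suc n)) (D-v² 0)) (ZP.*-assoc (+ suc n) (- + 2) (D p n))) ⟩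
    D p (suc n) + + suc n * (- + 2 * D p n) ∎
    where
    t : ℕ → ℤ
    t i = + (suc n C i) * (v ⋆ v) i * D p (suc n ∸ i)
    higher : ∀ i → t (suc (suc i)) ≡ 0ℤ
    higher i = begin
      + c * D (v ⋆ v) (suc i) * D p (n ∸ suc i)   ≡⟨ cong (λ z → + c * z * D p (n ∸ suc i)) (D-v² (suc i)) ⟩
      + c * 0ℤ * D p (n ∸ suc i)                  ≡⟨ cong (_* D p (n ∸ suc i)) (ZP.*-zeroʳ (+ c)) ⟩
      0ℤ * D p (n ∸ suc i)                        ≡⟨ ZP.*-zeroˡ (D p (n ∸ suc i)) ⟩
      0ℤ                                          ∎
      where
      c : ℕ
      c = suc n C suc (suc i)

  p-at-0 : p 0 ≡ + 1
  p-at-0 = begin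
    p 0                    ≡⟨ u-eq 0 ⟩
    + 1 + (u ⋆ p) 0        ≡⟨ cong (λ z → + 1 + z) (⋆-at-0 u p) ⟩
    + 1 + u 0 * p 0        ≡⟨ cong (λ z → + 1 + z * p 0) u0≡0 ⟩
    + 1 + 0ℤ * p 0         ≡⟨ cong (λ z → + 1 + z) (ZP.*-zeroˡ (p 0)) ⟩
    + 1                    ∎

  p-at-1 : p 1 ≡ + 1
  p-at-1 = begin
    p 1                    ≡⟨ ZP.*-identityˡ (p 1) ⟨
    + 1 * p 1              ≡⟨ cong (_* p 1) v²-at-0 ⟨
    (v ⋆ v) 0 * p 1        ≡⟨ ⋆-at-0 (v ⋆ v) (D p) ⟨
    ((v ⋆ v) ⋆ D p) 0      ≡⟨ v²-⋆-D-p 0 ⟩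
    p 0                    ≡⟨ p-at-0 ⟩
    + 1                    ∎

  p-rec : ∀ n → p (suc (suc n)) ≡ + suc (2 N.* suc n) * p (suc n)
  p-rec n = begin
    X                                     ≡⟨ add-and-subtract X Y c ⟩
    (X + c * (- + 2 * Y)) + + 2 * c * Y   ≡⟨ cong (λ z → z + + 2 * c * Y) (trans (sym (v²-⋆-D-p-at-suc n))
                                                                               (v²-⋆-D-p (suc n))) ⟩
    Y + + 2 * c * Y                       ≡⟨ factor Y c ⟩
    (+ 1 + + 2 * c) * Y                   ∎
    where
    X Y c : ℤ
    X = p (suc (suc n))
    Y = p (suc n)
    c = + suc n
    add-and-subtract : ∀ X Y c → X ≡ (X + c * (- + 2 * Y)) + + 2 * c * Y
    add-and-subtract = solve-∀
    factor : ∀ Y c → Y + + 2 * c * Y ≡ (+ 1 + + 2 * c) * Y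
    factor = solve-∀

  p≡oddFact : ∀ n → p n ≡ + oddFact n
  p≡oddFact zero = p-at-0
  p≡oddFact (suc zero) = p-at-1
  p≡oddFact (suc (suc n)) = begin
    p (suc (suc n))                            ≡⟨ p-rec n ⟩
    + suc (2 N.* suc n) * p (suc n)            ≡⟨ cong (+ suc (2 N.* suc n) *_) (p≡oddFact (suc n)) ⟩
    + suc (2 N.* suc n) * + oddFact (suc n)    ≡⟨ ZP.pos-* (suc (2 N.* suc n)) (oddFact (suc n)) ⟨
    + oddFact (suc (suc n))                    ∎

tS-unique : ∀ u → u 0 ≡ 0ℤ → D u ≗ oneS ⊕ u ⋆ D u → u ≗ tS
tS-unique u u0≡0 u-eq zero = u0≡0
tS-unique u u0≡0 u-eq (suc n) = TreeEquation.p≡oddFact u u0≡0 u-eq n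

-- Lists

map-const : {A B : Set} (b : B) (xs : List A) → map (λ _ → b) xs ≡ replicate (length xs) b
map-const b [] = refl
map-const b (x ∷ xs) = cong (b ∷_) (map-const b xs)

map-cartesianProductWith : {A B C A′ B′ C′ : Set} {f : A → B → C} {f′ : A′ → B′ → C′}
  (g : C → C′) (ga : A → A′) (gb : B → B′) → (∀ a b → g (f a b) ≡ f′ (ga a) (gb b)) →
  ∀ xs ys → map g (cartesianProductWith f xs ys) ≡ cartesianProductWith f′ (map ga xs) (map gb ys)
map-cartesianProductWith g ga gb natural [] ys = refl
map-cartesianProductWith {f = f} {f′} g ga gb natural (x ∷ xs) ys = begin
  map g (map (f x) ys ++ cartesianProductWith f xs ys)
    ≡⟨ LP.map-++ g (map (f x) ys) _ ⟩
  map g (map (f x) ys) ++ map g (cartesianProductWith f xs ys)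
    ≡⟨ cong₂ _++_ head (map-cartesianProductWith g ga gb natural xs ys) ⟩
  map (f′ (ga x)) (map gb ys) ++ cartesianProductWith f′ (map ga xs) (map gb ys) ∎
  where
  head : map g (map (f x) ys) ≡ map (f′ (ga x)) (map gb ys)
  head = trans (sym (LP.map-∘ ys)) (trans (LP.map-cong (natural x) ys) (LP.map-∘ ys))

unique-↭ : {A : Set} {xs ys : List A} → Unique xs → Unique ys → (∀ {z} → (z ∈ xs) ⇔ (z ∈ ys)) → xs ↭ ys
unique-↭ xs-uniq ys-uniq same = ∼bag⇒↭ (unique∧set⇒bag xs-uniq ys-uniq same)

Unique-resp-↭ : {A : Set} {xs ys : List A} → xs ↭ ys → Unique xs → Unique ys
Unique-resp-↭ {A} xs↭ys = PermS.Unique-resp-↭ (setoid A) (↭⇒↭ₛ xs↭ys)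

Unique-++⁻ : {A : Set} (xs : List A) {ys : List A} → Unique (xs ++ ys) →
  Unique xs × Unique ys × (∀ {z} → z ∈ xs → z ∉ ys)
Unique-++⁻ [] ys-uniq = [] , ys-uniq , λ ()
Unique-++⁻ (x ∷ xs) (x∉ ∷ xs++ys-uniq) with Unique-++⁻ xs xs++ys-uniq
... | xs-uniq , ys-uniq , disjoint =
  AllP.++⁻ˡ xs x∉ ∷ xs-uniq , ys-uniq ,
  λ { (here refl) z∈ys → All.lookup x∉ (∈-++⁺ʳ xs z∈ys) refl ; (there z∈xs) → disjoint z∈xs }

concatMap-unique : {A B : Set} (g : A → List B) {xs : List A} → Unique xs → (∀ {x} → x ∈ xs → Unique (g x)) →
  (∀ {x x′ v} → x ∈ xs → x′ ∈ xs → v ∈ g x → v ∈ g x′ → x ≡ x′) → Unique (concatMap g xs)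
concatMap-unique g {[]} _ _ _ = []
concatMap-unique g {x ∷ xs} (x∉xs ∷ xs-uniq) g-uniq g-disjoint =
  UP.++⁺ (g-uniq (here refl)) (concatMap-unique g xs-uniq (g-uniq ∘ there) (λ p q → g-disjoint (there p) (there q)))
    (λ (v∈gx , v∈gxs) →
      let x′ , x′∈xs , v∈gx′ = find (∈-concatMap⁻ g {xs = xs} v∈gxs) in
      All.lookup x∉xs x′∈xs (g-disjoint (here refl) (there x′∈xs) v∈gx v∈gx′))

sumMap : {A : Set} → (A → ℕ) → List A → ℕ
sumMap w xs = sumL (map w xs)

sumMap-++ : {A : Set} (w : A → ℕ) → ∀ xs ys → sumMap w (xs ++ ys) ≡ sumMap w xs N.+ sumMap w ys
sumMap-++ w [] ys = refl
sumMap-++ w (x ∷ xs) ys = trans (cong (w x N.+_) (sumMap-++ w xs ys)) (sym (NP.+-assoc (w x) _ _))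

sumMap-map : {A B : Set} (w : B → ℕ) (h : A → B) → ∀ xs → sumMap w (map h xs) ≡ sumMap (w ∘ h) xs
sumMap-map w h xs = cong sumL (sym (LP.map-∘ xs))

sumMap-cong : {A : Set} {w w′ : A → ℕ} → w ≗ w′ → ∀ xs → sumMap w xs ≡ sumMap w′ xs
sumMap-cong w≗w′ xs = cong sumL (LP.map-cong w≗w′ xs)

sumMap-cong-∈ : {A : Set} {w w′ : A → ℕ} → ∀ xs → (∀ {x} → x ∈ xs → w x ≡ w′ x) →
  sumMap w xs ≡ sumMap w′ xs
sumMap-cong-∈ xs w≗w′ = cong sumL (LP.map-cong-local (All.tabulate w≗w′))

sumMap-+ : {A : Set} (w w′ : A → ℕ) → ∀ xs → sumMap (λ x → w x N.+ w′ x) xs ≡ sumMap w xs N.+ sumMap w′ xs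
sumMap-+ w w′ [] = refl
sumMap-+ w w′ (x ∷ xs) =
  trans (cong (w x N.+ w′ x N.+_) (sumMap-+ w w′ xs)) (ℕ-interchange (w x) (w′ x) (sumMap w xs) (sumMap w′ xs))

*-distribˡ-sumMap : {A : Set} → ∀ c (w : A → ℕ) xs → c N.* sumMap w xs ≡ sumMap (λ x → c N.* w x) xs
*-distribˡ-sumMap c w [] = NP.*-zeroʳ c
*-distribˡ-sumMap c w (x ∷ xs) = trans (NP.*-distribˡ-+ c (w x) _) (cong (c N.* w x N.+_) (*-distribˡ-sumMap c w xs))

sumMap-concatMap : {A B : Set} (w : B → ℕ) (g : A → List B) → ∀ xs →
  sumMap w (concatMap g xs) ≡ sumMap (sumMap w ∘ g) xs
sumMap-concatMap w g [] = refl
sumMap-concatMap w g (x ∷ xs) = trans (sumMap-++ w (g x) (concatMap g xs)) (cong (sumMap w (g x) N.+_) (sumMap-concatMap w g xs))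

sumMap-cartesianProduct-∷ : {A : Set} (W : List A → ℕ) (w₁ w₂ : A → ℕ) (V₁ V₂ : List A → ℕ) →
  (∀ c cs → W (c ∷ cs) ≡ w₁ c N.* V₁ cs N.+ w₂ c N.* V₂ cs) → ∀ ts css →
  sumMap W (cartesianProductWith _∷_ ts css) ≡ sumMap w₁ ts N.* sumMap V₁ css N.+ sumMap w₂ ts N.* sumMap V₂ css
sumMap-cartesianProduct-∷ W w₁ w₂ V₁ V₂ W-cons [] css = refl
sumMap-cartesianProduct-∷ W w₁ w₂ V₁ V₂ W-cons (t ∷ ts) css = begin
  sumMap W (map (t ∷_) css ++ cartesianProductWith _∷_ ts css)
    ≡⟨ sumMap-++ W (map (t ∷_) css) _ ⟩
  sumMap W (map (t ∷_) css) N.+ sumMap W (cartesianProductWith _∷_ ts css)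
    ≡⟨ cong₂ N._+_ first (sumMap-cartesianProduct-∷ W w₁ w₂ V₁ V₂ W-cons ts css) ⟩
  (w₁ t N.* sumMap V₁ css N.+ w₂ t N.* sumMap V₂ css)
    N.+ (sumMap w₁ ts N.* sumMap V₁ css N.+ sumMap w₂ ts N.* sumMap V₂ css)
    ≡⟨ regroup (w₁ t) (w₂ t) (sumMap V₁ css) (sumMap V₂ css) (sumMap w₁ ts) (sumMap w₂ ts) ⟩
  (w₁ t N.+ sumMap w₁ ts) N.* sumMap V₁ css N.+ (w₂ t N.+ sumMap w₂ ts) N.* sumMap V₂ css ∎
  where
  first : sumMap W (map (t ∷_) css) ≡ w₁ t N.* sumMap V₁ css N.+ w₂ t N.* sumMap V₂ css
  first = begin
    sumMap W (map (t ∷_) css)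
      ≡⟨ sumMap-map W (t ∷_) css ⟩
    sumMap (λ cs → W (t ∷ cs)) css
      ≡⟨ trans (sumMap-cong (W-cons t) css) (sumMap-+ _ _ css) ⟩
    sumMap (λ cs → w₁ t N.* V₁ cs) css N.+ sumMap (λ cs → w₂ t N.* V₂ cs) css
      ≡⟨ cong₂ N._+_ (*-distribˡ-sumMap (w₁ t) V₁ css) (*-distribˡ-sumMap (w₂ t) V₂ css) ⟨
    w₁ t N.* sumMap V₁ css N.+ w₂ t N.* sumMap V₂ css ∎
  regroup : ∀ a b x y a′ b′ →
    (a N.* x N.+ b N.* y) N.+ (a′ N.* x N.+ b′ N.* y) ≡ (a N.+ a′) N.* x N.+ (b N.+ b′) N.* y
  regroup = NatSolver.solve-∀

sumL≡sum : ∀ xs → sumL xs ≡ sum xs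
sumL≡sum [] = refl
sumL≡sum (x ∷ xs) = cong (x N.+_) (sumL≡sum xs)

sumMap-↭ : {A : Set} (w : A → ℕ) {xs ys : List A} → xs ↭ ys → sumMap w xs ≡ sumMap w ys
sumMap-↭ w {xs} {ys} xs↭ys =
  trans (sumL≡sum (map w xs)) (trans (sum-↭ (PermP.map⁺ w xs↭ys)) (sym (sumL≡sum (map w ys))))

length-filter : {A : Set} {P : A → Set} (P? : Decidable P) → ∀ xs →
  length (filter P? xs) ≡ sumMap (λ x → ind ⌊ P? x ⌋) xs
length-filter P? [] = refl
length-filter P? (x ∷ xs) with P? x
... | yes _ = cong suc (length-filter P? xs)
... | no _ = length-filter P? xs

-- Enumerating increasing forests

splits : {A : Set} → List A → List (List A × List A)
splits [] = ([] , []) ∷ []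
splits (y ∷ L) = map (Prod.map₁ (y ∷_)) (splits L) ++ map (Prod.map₂ (y ∷_)) (splits L)

∈-splits-∷⁻ : {A : Set} (y : A) (L : List A) → ∀ {p} → p ∈ splits (y ∷ L) →
  (∃ λ q → q ∈ splits L × p ≡ Prod.map₁ (y ∷_) q) ⊎ (∃ λ q → q ∈ splits L × p ≡ Prod.map₂ (y ∷_) q)
∈-splits-∷⁻ y L p∈ with ∈-++⁻ (map (Prod.map₁ (y ∷_)) (splits L)) p∈
... | inj₁ p∈ˡ = inj₁ (∈-map⁻ (Prod.map₁ (y ∷_)) p∈ˡ)
... | inj₂ p∈ʳ = inj₂ (∈-map⁻ (Prod.map₂ (y ∷_)) p∈ʳ)

splits-perm : {A : Set} (L : List A) → ∀ {p} → p ∈ splits L → proj₁ p ++ proj₂ p ↭ L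
splits-perm [] (here refl) = ↭-refl
splits-perm (y ∷ L) p∈ with ∈-splits-∷⁻ y L p∈
... | inj₁ (q , q∈ , refl) = ↭-prep y (splits-perm L q∈)
... | inj₂ (q , q∈ , refl) = ↭-trans (PermP.shift y (proj₁ q) (proj₂ q)) (↭-prep y (splits-perm L q∈))

splits-length : {A : Set} (L : List A) → ∀ {p} → p ∈ splits L → length (proj₁ p) N.+ length (proj₂ p) ≡ length L
splits-length L {p} p∈ = trans (sym (LP.length-++ (proj₁ p))) (PermP.↭-length (splits-perm L p∈))

-- forests f L lists the plane forests of increasing trees labelled by the increasing list L:
-- for each split (S , R) of L, a first tree labelled by S, whose root is the least element of S,
-- followed by a forest labelled by R. The fuel f only has to exceed length L.
mutual
  forests : ℕ → List ℕ → List (List PTree)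
  forests zero _ = []
  forests (suc f) [] = [] ∷ []
  forests (suc f) (y ∷ L) = concatMap (consForests f) (splits (y ∷ L))

  consForests : ℕ → List ℕ × List ℕ → List (List PTree)
  consForests f (S , R) = cartesianProductWith _∷_ (trees f S) (forests f R)

  trees : ℕ → List ℕ → List PTree
  trees f [] = []
  trees f (x ∷ S) = map (node x) (forests f S)

mutual
  relabel : (ℕ → ℕ) → PTree → PTree
  relabel h (node x cs) = node (h x) (relabelF h cs)

  relabelF : (ℕ → ℕ) → List PTree → List PTree
  relabelF h [] = []
  relabelF h (c ∷ cs) = relabel h c ∷ relabelF h cs

splits-map : {A B : Set} (h : A → B) (L : List A) →
  splits (map h L) ≡ map (Prod.map (map h) (map h)) (splits L)
splits-map h [] = refl
splits-map {A} {B} h (y ∷ L) = begin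
  map (Prod.map₁ (h y ∷_)) (splits (map h L)) ++ map (Prod.map₂ (h y ∷_)) (splits (map h L))
    ≡⟨ cong (λ ps → map (Prod.map₁ (h y ∷_)) ps ++ map (Prod.map₂ (h y ∷_)) ps) (splits-map h L) ⟩
  map (Prod.map₁ (h y ∷_)) (map mapBoth (splits L)) ++ map (Prod.map₂ (h y ∷_)) (map mapBoth (splits L))
    ≡⟨ cong₂ _++_ (trans (sym (LP.map-∘ (splits L))) (LP.map-∘ (splits L)))
                  (trans (sym (LP.map-∘ (splits L))) (LP.map-∘ (splits L))) ⟩
  map mapBoth (map (Prod.map₁ (y ∷_)) (splits L)) ++ map mapBoth (map (Prod.map₂ (y ∷_)) (splits L))
    ≡⟨ LP.map-++ mapBoth (map (Prod.map₁ (y ∷_)) (splits L)) _ ⟨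
  map mapBoth (splits (y ∷ L)) ∎
  where
  mapBoth : List A × List A → List B × List B
  mapBoth = Prod.map (map h) (map h)

mutual
  forests-relabel : ∀ f h L → forests f (map h L) ≡ map (relabelF h) (forests f L)
  forests-relabel zero h L = refl
  forests-relabel (suc f) h [] = refl
  forests-relabel (suc f) h (y ∷ L) = begin
    concatMap (consForests f) (splits (map h (y ∷ L)))
      ≡⟨ cong (concatMap (consForests f)) (splits-map h (y ∷ L)) ⟩
    concatMap (consForests f) (map (Prod.map (map h) (map h)) (splits (y ∷ L)))
      ≡⟨ LP.concatMap-map (consForests f) (Prod.map (map h) (map h)) (splits (y ∷ L)) ⟩
    concatMap (λ p → consForests f (Prod.map (map h) (map h) p)) (splits (y ∷ L))
      ≡⟨ LP.concatMap-cong (consForests-relabel f h) (splits (y ∷ L)) ⟩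
    concatMap (λ p → map (relabelF h) (consForests f p)) (splits (y ∷ L))
      ≡⟨ LP.map-concatMap (relabelF h) (consForests f) (splits (y ∷ L)) ⟨
    map (relabelF h) (forests (suc f) (y ∷ L)) ∎

  consForests-relabel : ∀ f h p →
    consForests f (Prod.map (map h) (map h) p) ≡ map (relabelF h) (consForests f p)
  consForests-relabel f h (S , R) = begin
    cartesianProductWith _∷_ (trees f (map h S)) (forests f (map h R))
      ≡⟨ cong₂ (cartesianProductWith _∷_) (trees-relabel f h S) (forests-relabel f h R) ⟩
    cartesianProductWith _∷_ (map (relabel h) (trees f S)) (map (relabelF h) (forests f R))
      ≡⟨ map-cartesianProductWith (relabelF h) (relabel h) (relabelF h) (λ _ _ → refl) (trees f S) (forests f R) ⟨
    map (relabelF h) (consForests f (S , R)) ∎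

  trees-relabel : ∀ f h S → trees f (map h S) ≡ map (relabel h) (trees f S)
  trees-relabel f h [] = refl
  trees-relabel f h (x ∷ S) = begin
    map (node (h x)) (forests f (map h S))              ≡⟨ cong (map (node (h x))) (forests-relabel f h S) ⟩
    map (node (h x)) (map (relabelF h) (forests f S))   ≡⟨ LP.map-∘ (forests f S) ⟨
    map (relabel h ∘ node x) (forests f S)              ≡⟨ LP.map-∘ (forests f S) ⟩
    map (relabel h) (map (node x) (forests f S))        ∎

forests-fuel : ∀ f f′ L → length L < f → length L < f′ → forests f L ≡ forests f′ L
forests-fuel (suc f) (suc f′) [] _ _ = refl
forests-fuel (suc f) (suc f′) (y ∷ L) (s≤s |L|<f) (s≤s |L|<f′) =
  cong concat (LP.map-cong-local (All.tabulate (λ {p} p∈ → same p p∈)))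
  where
  same : ∀ p → p ∈ splits (y ∷ L) → consForests f p ≡ consForests f′ p
  same ([] , R) _ = refl
  same (x ∷ S , R) p∈ = cong₂ (λ ts cs → cartesianProductWith _∷_ (map (node x) ts) cs)
    (forests-fuel f f′ S (NP.<-≤-trans (s≤s |S|≤|L|) |L|<f) (NP.<-≤-trans (s≤s |S|≤|L|) |L|<f′))
    (forests-fuel f f′ R (NP.<-≤-trans (s≤s |R|≤|L|) |L|<f) (NP.<-≤-trans (s≤s |R|≤|L|) |L|<f′))
    where
    |S|+|R|≡|L| : length S N.+ length R ≡ length L
    |S|+|R|≡|L| = NP.suc-injective (splits-length (y ∷ L) p∈)
    |S|≤|L| : length S ≤ length L
    |S|≤|L| = subst (length S ≤_) |S|+|R|≡|L| (NP.m≤m+n (length S) (length R))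
    |R|≤|L| : length R ≤ length L
    |R|≤|L| = subst (length R ≤_) |S|+|R|≡|L| (NP.m≤n+m (length R) (length S))

-- Sums of label-independent weights

LabelIndependent : (PTree → ℕ) → Set
LabelIndependent w = ∀ t → w (relabel (λ _ → 0) t) ≡ w t

LabelIndependentF : (List PTree → ℕ) → Set
LabelIndependentF W = ∀ cs → W (relabelF (λ _ → 0) cs) ≡ W cs

-- Sums over all forests, resp. trees, on n labels; as the weights ignore labels, the label
-- list 0, …, 0 of length n serves as well as any other.
forestSum : (List PTree → ℕ) → ℕ → ℕ
forestSum W n = sumMap W (forests (suc n) (replicate n 0))

treeSum : (PTree → ℕ) → ℕ → ℕ
treeSum w zero = 0
treeSum w (suc n) = forestSum (w ∘ node 0) n

forests-sum : ∀ W → LabelIndependentF W → ∀ f L → length L < f → sumMap W (forests f L) ≡ forestSum W (length L)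
forests-sum W W-ind f L |L|<f = begin
  sumMap W (forests f L)
    ≡⟨ cong (sumMap W) (forests-fuel f (suc n) L |L|<f NP.≤-refl) ⟩
  sumMap W (forests (suc n) L)
    ≡⟨ sumMap-cong (λ cs → sym (W-ind cs)) (forests (suc n) L) ⟩
  sumMap (W ∘ relabelF erase) (forests (suc n) L)
    ≡⟨ sumMap-map W (relabelF erase) (forests (suc n) L) ⟨
  sumMap W (map (relabelF erase) (forests (suc n) L))
    ≡⟨ cong (sumMap W) (forests-relabel (suc n) erase L) ⟨
  sumMap W (forests (suc n) (map erase L))
    ≡⟨ cong (λ ls → sumMap W (forests (suc n) ls)) (map-const 0 L) ⟩
  forestSum W n ∎
  where
  n : ℕ
  n = length L
  erase : ℕ → ℕ
  erase _ = 0

trees-sum : ∀ w → LabelIndependent w → ∀ f S → length S ≤ f → sumMap w (trees f S) ≡ treeSum w (length S)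
trees-sum w w-ind f [] _ = refl
trees-sum w w-ind f (x ∷ S) |S|<f = begin
  sumMap w (map (node x) (forests f S))
    ≡⟨ sumMap-map w (node x) (forests f S) ⟩
  sumMap (w ∘ node x) (forests f S)
    ≡⟨ sumMap-cong (λ cs → trans (sym (w-ind (node x cs))) (w-ind (node 0 cs))) (forests f S) ⟩
  sumMap (w ∘ node 0) (forests f S)
    ≡⟨ forests-sum (w ∘ node 0) (λ cs → w-ind (node 0 cs)) f S |S|<f ⟩
  treeSum w (suc (length S)) ∎

sumMap-splits : {A : Set} (φ : ℕ → ℕ → ℕ) (L : List A) →
  + sumMap (λ p → φ (length (proj₁ p)) (length (proj₂ p))) (splits L) ≡ binomialSum (length L) (λ i j → + φ i j)
sumMap-splits φ [] = trans (cong +_ (NP.+-identityʳ (φ 0 0))) (sym (ZP.*-identityˡ (+ φ 0 0)))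
sumMap-splits {A} φ (y ∷ L) = begin
  + sumMap w (map (Prod.map₁ (y ∷_)) (splits L) ++ map (Prod.map₂ (y ∷_)) (splits L))
    ≡⟨ cong +_ (sumMap-++ w (map (Prod.map₁ (y ∷_)) (splits L)) _) ⟩
  + (sumMap w (map (Prod.map₁ (y ∷_)) (splits L)) N.+ sumMap w (map (Prod.map₂ (y ∷_)) (splits L)))
    ≡⟨ ZP.pos-+ (sumMap w (map (Prod.map₁ (y ∷_)) (splits L))) _ ⟩
  + sumMap w (map (Prod.map₁ (y ∷_)) (splits L)) + + sumMap w (map (Prod.map₂ (y ∷_)) (splits L))
    ≡⟨ cong₂ (λ a b → + a + + b) (sumMap-map w (Prod.map₁ (y ∷_)) (splits L))
                                 (sumMap-map w (Prod.map₂ (y ∷_)) (splits L)) ⟩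
  + sumMap (λ p → φ (suc (length (proj₁ p))) (length (proj₂ p))) (splits L)
    + + sumMap (λ p → φ (length (proj₁ p)) (suc (length (proj₂ p)))) (splits L)
    ≡⟨ cong₂ _+_ (sumMap-splits (λ i j → φ (suc i) j) L) (sumMap-splits (λ i j → φ i (suc j)) L) ⟩
  binomialSum (length L) (λ i j → + φ (suc i) j) + binomialSum (length L) (λ i j → + φ i (suc j))
    ≡⟨ binomialSum-suc (length L) (λ i j → + φ i j) ⟨
  binomialSum (suc (length L)) (λ i j → + φ i j) ∎
  where
  w : List A × List A → ℕ
  w p = φ (length (proj₁ p)) (length (proj₂ p))

treeS : (PTree → ℕ) → Series
treeS w n = + treeSum w n

forestS : (List PTree → ℕ) → Series
forestS W n = + forestSum W n

-- A forest on m + 1 labels is a first tree on i of them followed by a forest on the others.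
forestS-cons : ∀ W w₁ V₁ w₂ V₂ →
  LabelIndependent w₁ → LabelIndependentF V₁ → LabelIndependent w₂ → LabelIndependentF V₂ →
  (∀ c cs → W (c ∷ cs) ≡ w₁ c N.* V₁ cs N.+ w₂ c N.* V₂ cs) →
  ∀ m → forestS W (suc m) ≡ (treeS w₁ ⋆ forestS V₁ ⊕ treeS w₂ ⋆ forestS V₂) (suc m)
forestS-cons W w₁ V₁ w₂ V₂ w₁-ind V₁-ind w₂-ind V₂-ind W-cons m = begin
  + sumMap W (concatMap (consForests (suc m)) (splits L))
    ≡⟨ cong +_ (sumMap-concatMap W (consForests (suc m)) (splits L)) ⟩
  + sumMap (sumMap W ∘ consForests (suc m)) (splits L)
    ≡⟨ cong +_ (sumMap-cong-∈ (splits L) (λ {p} → split-sum p)) ⟩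
  + sumMap (λ p → φ (length (proj₁ p)) (length (proj₂ p))) (splits L)
    ≡⟨ sumMap-splits φ L ⟩
  binomialSum (suc (length (replicate m 0))) (λ i j → + φ i j)
    ≡⟨ cong (λ k → binomialSum (suc k) (λ i j → + φ i j)) (LP.length-replicate m) ⟩
  binomialSum (suc m) (λ i j → + φ i j)
    ≡⟨ binomialSum-cong (suc m) (λ i j → trans (ZP.pos-+ (treeSum w₁ i N.* forestSum V₁ j) _)
                      (cong₂ _+_ (ZP.pos-* (treeSum w₁ i) (forestSum V₁ j)) (ZP.pos-* (treeSum w₂ i) (forestSum V₂ j)))) ⟩
  binomialSum (suc m) (λ i j → treeS w₁ i * forestS V₁ j + treeS w₂ i * forestS V₂ j)
    ≡⟨ binomialSum-+ (suc m) (λ i j → treeS w₁ i * forestS V₁ j) (λ i j → treeS w₂ i * forestS V₂ j) ⟩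
  binomialSum (suc m) (λ i j → treeS w₁ i * forestS V₁ j) + binomialSum (suc m) (λ i j → treeS w₂ i * forestS V₂ j)
    ≡⟨ cong₂ _+_ (⋆-as-binomialSum (treeS w₁) (forestS V₁) (suc m))
                 (⋆-as-binomialSum (treeS w₂) (forestS V₂) (suc m)) ⟨
  (treeS w₁ ⋆ forestS V₁) (suc m) + (treeS w₂ ⋆ forestS V₂) (suc m) ∎
  where
  L : List ℕ
  L = replicate (suc m) 0
  φ : ℕ → ℕ → ℕ
  φ i j = treeSum w₁ i N.* forestSum V₁ j N.+ treeSum w₂ i N.* forestSum V₂ j
  split-sum : ∀ p → p ∈ splits L → sumMap W (consForests (suc m) p) ≡ φ (length (proj₁ p)) (length (proj₂ p))
  split-sum ([] , R) _ = refl
  split-sum (x ∷ S , R) p∈ = begin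
    sumMap W (cartesianProductWith _∷_ (trees (suc m) (x ∷ S)) (forests (suc m) R))
      ≡⟨ sumMap-cartesianProduct-∷ W w₁ w₂ V₁ V₂ W-cons (trees (suc m) (x ∷ S)) (forests (suc m) R) ⟩
    sumMap w₁ (trees (suc m) (x ∷ S)) N.* sumMap V₁ (forests (suc m) R)
      N.+ sumMap w₂ (trees (suc m) (x ∷ S)) N.* sumMap V₂ (forests (suc m) R)
      ≡⟨ cong₂ N._+_ (cong₂ N._*_ (trees-sum w₁ w₁-ind (suc m) (x ∷ S) |S|≤) (forests-sum V₁ V₁-ind (suc m) R |R|<))
                     (cong₂ N._*_ (trees-sum w₂ w₂-ind (suc m) (x ∷ S) |S|≤) (forests-sum V₂ V₂-ind (suc m) R |R|<)) ⟩
    φ (suc (length S)) (length R) ∎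
    where
    |S|+|R| : suc (length S) N.+ length R ≡ suc m
    |S|+|R| = trans (splits-length L p∈) (LP.length-replicate (suc m))
    |S|≤ : suc (length S) ≤ suc m
    |S|≤ = subst (suc (length S) ≤_) |S|+|R| (NP.m≤m+n (suc (length S)) (length R))
    |R|< : length R < suc m
    |R|< = subst (length R <_) |S|+|R| (NP.m<n+m (length R) (s≤s z≤n))

constS : ℕ → Series
constS a zero = + a
constS a (suc _) = 0ℤ

constS-0 : constS 0 ≗ zeroS
constS-0 zero = refl
constS-0 (suc _) = refl

treeS-zero : treeS (λ _ → 0) ≗ zeroS
treeS-zero zero = refl
treeS-zero (suc n) = cong +_ (sumMap-zero (forests (suc n) (replicate n 0)))
  where
  sumMap-zero : ∀ (css : List (List PTree)) → sumMap (λ _ → 0) css ≡ 0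
  sumMap-zero [] = refl
  sumMap-zero (_ ∷ css) = sumMap-zero css

forestS-cons₁ : ∀ W w V → LabelIndependent w → LabelIndependentF V →
  (∀ c cs → W (c ∷ cs) ≡ w c N.* V cs) → forestS W ≗ constS (W []) ⊕ treeS w ⋆ forestS V
forestS-cons₁ W w V w-ind V-ind W-cons zero = begin
  + (W [] N.+ 0)                          ≡⟨ cong +_ (NP.+-identityʳ (W [])) ⟩
  + W []                                  ≡⟨ ZP.+-identityʳ (+ W []) ⟨
  + W [] + treeS w 0 * forestS V 0        ≡⟨ cong (λ z → + W [] + z) (⋆-at-0 (treeS w) (forestS V)) ⟨
  + W [] + (treeS w ⋆ forestS V) 0        ∎
forestS-cons₁ W w V w-ind V-ind W-cons (suc m) = begin
  forestS W (suc m)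
    ≡⟨ forestS-cons W w V (λ _ → 0) (λ _ → 0) w-ind V-ind (λ _ → refl) (λ _ → refl)
                    (λ c cs → trans (W-cons c cs) (sym (NP.+-identityʳ _))) m ⟩
  (treeS w ⋆ forestS V) (suc m) + (treeS (λ _ → 0) ⋆ forestS (λ _ → 0)) (suc m)
    ≡⟨ cong (λ z → (treeS w ⋆ forestS V) (suc m) + z)
            (trans (⋆-congʳ (forestS (λ _ → 0)) treeS-zero (suc m)) (⋆-zeroˡ (forestS (λ _ → 0)) (suc m))) ⟩
  (treeS w ⋆ forestS V) (suc m) + 0ℤ
    ≡⟨ ZP.+-comm ((treeS w ⋆ forestS V) (suc m)) 0ℤ ⟩
  0ℤ + (treeS w ⋆ forestS V) (suc m) ∎

forestS-product : ∀ w V → LabelIndependent w → LabelIndependentF V → V [] ≡ 1 →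
  (∀ c cs → V (c ∷ cs) ≡ w c N.* V cs) → forestS V ≗ inv1m (treeS w)
forestS-product w V w-ind V-ind V[]≡1 V-cons =
  ⋆-fixpoint-unique (treeS w) oneS refl V-eq (inv1m-fixpoint (treeS w) refl)
  where
  V-eq : forestS V ≗ oneS ⊕ treeS w ⋆ forestS V
  V-eq zero = trans (forestS-cons₁ V w V w-ind V-ind V-cons zero) (cong (λ a → + a + (treeS w ⋆ forestS V) 0) V[]≡1)
  V-eq (suc n) = forestS-cons₁ V w V w-ind V-ind V-cons (suc n)

forestS-count : forestS (λ _ → 1) ≗ inv1m (treeS (λ _ → 1))
forestS-count = forestS-product (λ _ → 1) (λ _ → 1) (λ _ → refl) (λ _ → refl) refl (λ _ _ → refl)

treeS-count : treeS (λ _ → 1) ≗ tS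
treeS-count = tS-unique u refl u-eq
  where
  u : Series
  u = treeS (λ _ → 1)
  u-eq : D u ≗ oneS ⊕ u ⋆ D u
  u-eq n = begin
    D u n                     ≡⟨ forestS-count n ⟩
    inv1m u n                 ≡⟨ inv1m-fixpoint u refl n ⟩
    oneS n + (u ⋆ inv1m u) n  ≡⟨ cong (λ z → oneS n + z) (⋆-congˡ u (sym ∘ forestS-count) n) ⟩
    oneS n + (u ⋆ D u) n      ∎

-- Correctness of the enumeration

splits-⊆ : {A : Set} (L : List A) → ∀ {p} → p ∈ splits L →
  (∀ {z} → z ∈ proj₁ p → z ∈ L) × (∀ {z} → z ∈ proj₂ p → z ∈ L)
splits-⊆ L {p} p∈ = (λ z∈ → PermP.∈-resp-↭ (splits-perm L p∈) (∈-++⁺ˡ z∈))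
                  , (λ z∈ → PermP.∈-resp-↭ (splits-perm L p∈) (∈-++⁺ʳ (proj₁ p) z∈))

splits-AllPairs : {A : Set} {R : A → A → Set} (L : List A) → ∀ {p} → p ∈ splits L → AllPairs R L →
  AllPairs R (proj₁ p) × AllPairs R (proj₂ p)
splits-AllPairs [] (here refl) [] = [] , []
splits-AllPairs (y ∷ L) p∈ (y-R ∷ L-R) with ∈-splits-∷⁻ y L p∈
... | inj₁ (q , q∈ , refl) = Prod.map₁ (All.tabulate (All.lookup y-R ∘ proj₁ (splits-⊆ L q∈)) ∷_) (splits-AllPairs L q∈ L-R)
... | inj₂ (q , q∈ , refl) = Prod.map₂ (All.tabulate (All.lookup y-R ∘ proj₂ (splits-⊆ L q∈)) ∷_) (splits-AllPairs L q∈ L-R)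

splits-unique : {A : Set} (L : List A) → Unique L → Unique (splits L)
splits-unique [] _ = [] ∷ []
splits-unique (y ∷ L) (y∉L ∷ L-uniq) = UP.++⁺ (UP.map⁺ map₁-injective U) (UP.map⁺ map₂-injective U) disjoint
  where
  U : Unique (splits L)
  U = splits-unique L L-uniq
  map₁-injective : ∀ {p q} → Prod.map₁ (y ∷_) p ≡ Prod.map₁ (y ∷_) q → p ≡ q
  map₁-injective {_ , _} {_ , _} refl = refl
  map₂-injective : ∀ {p q} → Prod.map₂ (y ∷_) p ≡ Prod.map₂ (y ∷_) q → p ≡ q
  map₂-injective {_ , _} {_ , _} refl = refl
  disjoint : ∀ {v} → ¬ (v ∈ map (Prod.map₁ (y ∷_)) (splits L) × v ∈ map (Prod.map₂ (y ∷_)) (splits L))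
  disjoint (v∈ˡ , v∈ʳ) with ∈-map⁻ (Prod.map₁ (y ∷_)) v∈ˡ | ∈-map⁻ (Prod.map₂ (y ∷_)) v∈ʳ
  ... | _ , _ , refl | q , q∈ , v≡ =
    All.lookup y∉L (proj₁ (splits-⊆ L q∈) (subst (y ∈_) (cong proj₁ v≡) (here refl))) refl

splits-injective : {A : Set} (L : List A) → Unique L → ∀ {p p′} → p ∈ splits L → p′ ∈ splits L →
  proj₁ p ↭ proj₁ p′ → p ≡ p′
splits-injective [] _ (here refl) (here refl) _ = refl
splits-injective (y ∷ L) (y∉L ∷ L-uniq) p∈ p′∈ p₁↭p′₁ with ∈-splits-∷⁻ y L p∈ | ∈-splits-∷⁻ y L p′∈
... | inj₁ (q , q∈ , refl) | inj₁ (q′ , q′∈ , refl) =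
  cong (Prod.map₁ (y ∷_)) (splits-injective L L-uniq q∈ q′∈ (PermP.drop-∷ p₁↭p′₁))
... | inj₂ (q , q∈ , refl) | inj₂ (q′ , q′∈ , refl) =
  cong (Prod.map₂ (y ∷_)) (splits-injective L L-uniq q∈ q′∈ p₁↭p′₁)
... | inj₁ (q , q∈ , refl) | inj₂ (q′ , q′∈ , refl) =
  ⊥-elim (All.lookup y∉L (proj₁ (splits-⊆ L q′∈) (PermP.∈-resp-↭ p₁↭p′₁ (here refl))) refl)
... | inj₂ (q , q∈ , refl) | inj₁ (q′ , q′∈ , refl) =
  ⊥-elim (All.lookup y∉L (proj₁ (splits-⊆ L q∈) (PermP.∈-resp-↭ (↭-sym p₁↭p′₁) (here refl))) refl)

splits-filter : {A : Set} {P : A → Set} (P? : Decidable P) (L : List A) →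
  (filter P? L , filter (¬? ∘ P?) L) ∈ splits L
splits-filter P? [] = here refl
splits-filter P? (y ∷ L) with P? y
... | yes _ = ∈-++⁺ˡ (∈-map⁺ (Prod.map₁ (y ∷_)) (splits-filter P? L))
... | no _ = ∈-++⁺ʳ (map (Prod.map₁ (y ∷_)) (splits L)) (∈-map⁺ (Prod.map₂ (y ∷_)) (splits-filter P? L))

All⇒IncreasingF : ∀ x cs → All (λ c → x < root c) cs → All Increasing cs → IncreasingF x cs
All⇒IncreasingF x [] _ _ = tt
All⇒IncreasingF x (c ∷ cs) (x<c ∷ x<cs) (c-inc ∷ cs-inc) = x<c , c-inc , All⇒IncreasingF x cs x<cs cs-inc

IncreasingF⇒All : ∀ x cs → IncreasingF x cs → All (λ c → x < root c) cs × All Increasing cs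
IncreasingF⇒All x [] _ = [] , []
IncreasingF⇒All x (c ∷ cs) (x<c , c-inc , rest) =
  Prod.map (x<c ∷_) (c-inc ∷_) (IncreasingF⇒All x cs rest)

root∈labels : ∀ t → root t ∈ labels t
root∈labels (node x cs) = here refl

mutual
  trees-sound : ∀ f S {t} → AllPairs _<_ S → t ∈ trees f S → labels t ↭ S × Increasing t
  trees-sound f (x ∷ S) (x<S ∷ S-sorted) t∈ with ∈-map⁻ (node x) t∈
  ... | cs , cs∈ , refl with forests-sound f S S-sorted cs∈
  ...   | cs↭S , cs-inc , roots∈S =
    ↭-prep x cs↭S , All⇒IncreasingF x cs (All.map (All.lookup x<S) roots∈S) cs-inc

  forests-sound : ∀ f L {cs} → AllPairs _<_ L → cs ∈ forests f L →
    labelsF cs ↭ L × All Increasing cs × All (λ c → root c ∈ L) cs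
  forests-sound (suc f) [] _ (here refl) = ↭-refl , [] , []
  forests-sound (suc f) (y ∷ L) L-sorted cs∈ with find (∈-concatMap⁻ (consForests f) {xs = splits (y ∷ L)} cs∈)
  ... | (S , R) , p∈ , cs∈′ with ∈-cartesianProductWith⁻ _∷_ (trees f S) (forests f R) cs∈′
  ...   | c , cs , c∈ , cs∈″ , refl =
    ↭-trans (PermP.++⁺ c↭S cs↭R) (splits-perm (y ∷ L) p∈) ,
    c-inc ∷ cs-inc ,
    S⊆L (PermP.∈-resp-↭ c↭S (root∈labels c)) ∷ All.map R⊆L roots∈R
    where
    S⊆L : ∀ {z} → z ∈ S → z ∈ y ∷ L
    S⊆L = proj₁ (splits-⊆ (y ∷ L) p∈)
    R⊆L : ∀ {z} → z ∈ R → z ∈ y ∷ L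
    R⊆L = proj₂ (splits-⊆ (y ∷ L) p∈)
    S,R-sorted : AllPairs _<_ S × AllPairs _<_ R
    S,R-sorted = splits-AllPairs (y ∷ L) p∈ L-sorted
    c-sound : labels c ↭ S × Increasing c
    c-sound = trees-sound f S (proj₁ S,R-sorted) c∈
    c↭S : labels c ↭ S
    c↭S = proj₁ c-sound
    c-inc : Increasing c
    c-inc = proj₂ c-sound
    cs-sound : labelsF cs ↭ R × All Increasing cs × All (λ c → root c ∈ R) cs
    cs-sound = forests-sound f R (proj₂ S,R-sorted) cs∈″
    cs↭R : labelsF cs ↭ R
    cs↭R = proj₁ cs-sound
    cs-inc : All Increasing cs
    cs-inc = proj₁ (proj₂ cs-sound)
    roots∈R : All (λ c → root c ∈ R) cs
    roots∈R = proj₂ (proj₂ cs-sound)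

mutual
  root-least : ∀ t → Increasing t → ∀ {z} → z ∈ labels t → root t ≤ z
  root-least (node x cs) _ (here refl) = NP.≤-refl
  root-least (node x cs) cs-inc (there z∈) = NP.<⇒≤ (labelsF-above x cs cs-inc z∈)

  labelsF-above : ∀ x cs → IncreasingF x cs → ∀ {z} → z ∈ labelsF cs → x < z
  labelsF-above x (c ∷ cs) (x<c , c-inc , cs-inc) z∈ with ∈-++⁻ (labels c) z∈
  ... | inj₁ z∈c = NP.<-≤-trans x<c (root-least c c-inc z∈c)
  ... | inj₂ z∈cs = labelsF-above x cs cs-inc z∈cs

root≡least : ∀ t {x L} → AllPairs _<_ (x ∷ L) → Increasing t → labels t ↭ x ∷ L → root t ≡ x
root≡least t (x<L ∷ _) t-inc t↭ with PermP.∈-resp-↭ t↭ (root∈labels t)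
... | here root≡x = root≡x
... | there root∈L =
  ⊥-elim (NP.<⇒≱ (All.lookup x<L root∈L) (root-least t t-inc (PermP.∈-resp-↭ (↭-sym t↭) (here refl))))

mutual
  trees-complete : ∀ f S t → length S ≤ f → AllPairs _<_ S → labels t ↭ S → Increasing t → t ∈ trees f S
  trees-complete f [] (node r ds) _ _ t↭ _ = ⊥-elim (PermP.¬x∷xs↭[] t↭)
  trees-complete f (x ∷ S) (node r ds) |S|<f S-sorted@(_ ∷ S′-sorted) t↭ t-inc
    with refl ← root≡least (node r ds) S-sorted t-inc t↭ =
    ∈-map⁺ (node r) (forests-complete f S ds |S|<f S′-sorted (PermP.drop-∷ t↭) (proj₂ (IncreasingF⇒All r ds t-inc)))

  forests-complete : ∀ f L cs → length L < f → AllPairs _<_ L → labelsF cs ↭ L → All Increasing cs → cs ∈ forests f L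
  forests-complete (suc f) [] [] _ _ _ _ = here refl
  forests-complete (suc f) (y ∷ L) [] _ _ cs↭ _ = ⊥-elim (PermP.¬x∷xs↭[] (↭-sym cs↭))
  forests-complete (suc f) [] (node _ _ ∷ _) _ _ cs↭ _ = ⊥-elim (PermP.¬x∷xs↭[] cs↭)
  forests-complete (suc f) (y ∷ L) (c@(node r ds) ∷ cs) (s≤s |L|<f) L-sorted c∷cs↭ (c-inc ∷ cs-inc) =
    ∈-concatMap⁺ (consForests f) (lose split∈ (∈-cartesianProductWith⁺ _∷_ c∈ cs∈))
    where
    L′ : List ℕ
    L′ = y ∷ L
    L′-uniq : Unique L′
    L′-uniq = AllPairs.map NP.<⇒≢ L-sorted
    c,cs-uniq : Unique (labels c) × Unique (labelsF cs) × (∀ {z} → z ∈ labels c → z ∉ labelsF cs)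
    c,cs-uniq = Unique-++⁻ (labels c) (Unique-resp-↭ (↭-sym c∷cs↭) L′-uniq)
    in-c? : Decidable (_∈ labels c)
    in-c? z = z ∈? labels c
    S R : List ℕ
    S = filter in-c? L′
    R = filter (¬? ∘ in-c?) L′
    split∈ : (S , R) ∈ splits L′
    split∈ = splits-filter in-c? L′
    S,R-sorted : AllPairs _<_ S × AllPairs _<_ R
    S,R-sorted = splits-AllPairs L′ split∈ L-sorted
    ∈L′ : ∀ {z} → z ∈ labels c ++ labelsF cs → z ∈ L′
    ∈L′ = PermP.∈-resp-↭ c∷cs↭
    c↭S : labels c ↭ S
    c↭S = unique-↭ (proj₁ c,cs-uniq) (UP.filter⁺ in-c? L′-uniq)
      (mk⇔ (λ z∈ → ∈-filter⁺ in-c? (∈L′ (∈-++⁺ˡ z∈)) z∈) (λ z∈ → proj₂ (∈-filter⁻ in-c? {xs = L′} z∈)))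
    cs↭R : labelsF cs ↭ R
    cs↭R = unique-↭ (proj₁ (proj₂ c,cs-uniq)) (UP.filter⁺ (¬? ∘ in-c?) L′-uniq)
      (mk⇔ (λ z∈ → ∈-filter⁺ (¬? ∘ in-c?) (∈L′ (∈-++⁺ʳ (labels c) z∈))
                             (λ z∈c → proj₂ (proj₂ c,cs-uniq) z∈c z∈))
           (λ z∈ → let z∈L′ , z∉c = ∈-filter⁻ (¬? ∘ in-c?) {xs = L′} z∈ in
                   [ ⊥-elim ∘ z∉c , id ]′ (∈-++⁻ (labels c) (PermP.∈-resp-↭ (↭-sym c∷cs↭) z∈L′))))
    |S|+|R| : length S N.+ length R ≡ suc (length L)
    |S|+|R| = splits-length L′ split∈
    |S|≤f : length S ≤ f
    |S|≤f = NP.≤-trans (subst (length S ≤_) |S|+|R| (NP.m≤m+n (length S) (length R))) |L|<f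
    |R|<f : length R < f
    |R|<f = NP.<-≤-trans (subst (length R <_) |S|+|R| (NP.m<n+m (length R) 0<|S|)) |L|<f
      where
      0<|S| : 0 < length S
      0<|S| = subst (0 <_) (PermP.↭-length c↭S) (s≤s z≤n)
    c∈ : c ∈ trees f S
    c∈ = trees-complete f S c |S|≤f (proj₁ S,R-sorted) c↭S c-inc
    cs∈ : cs ∈ forests f R
    cs∈ = forests-complete f R cs |R|<f (proj₂ S,R-sorted) cs↭R cs-inc

node-injective : ∀ {x cs cs′} → node x cs ≡ node x cs′ → cs ≡ cs′
node-injective refl = refl

mutual
  trees-unique : ∀ f S → AllPairs _<_ S → Unique (trees f S)
  trees-unique f [] _ = []
  trees-unique f (x ∷ S) (_ ∷ S-sorted) = UP.map⁺ node-injective (forests-unique f S S-sorted)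

  forests-unique : ∀ f L → AllPairs _<_ L → Unique (forests f L)
  forests-unique zero L _ = []
  forests-unique (suc f) [] _ = [] ∷ []
  forests-unique (suc f) (y ∷ L) L-sorted =
    concatMap-unique (consForests f) (splits-unique (y ∷ L) L-uniq) consForests-unique same-first-tree
    where
    L-uniq : Unique (y ∷ L)
    L-uniq = AllPairs.map NP.<⇒≢ L-sorted
    consForests-unique : ∀ {p} → p ∈ splits (y ∷ L) → Unique (consForests f p)
    consForests-unique {S , R} p∈ = UP.cartesianProductWith⁺ _∷_ LP.∷-injective
      (trees-unique f S (proj₁ (splits-AllPairs (y ∷ L) p∈ L-sorted)))
      (forests-unique f R (proj₂ (splits-AllPairs (y ∷ L) p∈ L-sorted)))
    same-first-tree : ∀ {p p′ v} → p ∈ splits (y ∷ L) → p′ ∈ splits (y ∷ L) →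
      v ∈ consForests f p → v ∈ consForests f p′ → p ≡ p′
    same-first-tree {S , R} {S′ , R′} p∈ p′∈ v∈ v∈′
      with ∈-cartesianProductWith⁻ _∷_ (trees f S) (forests f R) v∈
         | ∈-cartesianProductWith⁻ _∷_ (trees f S′) (forests f R′) v∈′
    ... | c , _ , c∈ , _ , refl | c′ , _ , c′∈ , _ , c∷≡c′∷ with refl ← LP.∷-injectiveˡ c∷≡c′∷ =
      splits-injective (y ∷ L) L-uniq p∈ p′∈
        (↭-trans (↭-sym (proj₁ (trees-sound f S (proj₁ (splits-AllPairs (y ∷ L) p∈ L-sorted)) c∈)))
                 (proj₁ (trees-sound f S′ (proj₁ (splits-AllPairs (y ∷ L) p′∈ L-sorted)) c′∈)))

sorted-suc-upTo : ∀ n → AllPairs _<_ (map suc (upTo n))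
sorted-suc-upTo n = AllPairsP.map⁺ (AllPairsP.applyUpTo⁺₁ id n (λ i<j _ → s≤s i<j))

length-suc-upTo : ∀ n → length (map suc (upTo n)) ≡ n
length-suc-upTo n = trans (LP.length-map suc (upTo n)) (LP.length-upTo n)

module Enumeration (enum : ℕ → List PTree) (enum-spec : ∀ n t → (t ∈ enum n) ⇔ IsPIT n t)
                   (enum-unique : ∀ n → Unique (enum n)) where

  enum↭trees : ∀ n → enum n ↭ trees n (map suc (upTo n))
  enum↭trees n = unique-↭ (enum-unique n) (trees-unique n L (sorted-suc-upTo n)) (mk⇔ complete sound)
    where
    L : List ℕ
    L = map suc (upTo n)
    complete : ∀ {t} → t ∈ enum n → t ∈ trees n L
    complete {t} t∈ = let t↭ , t-inc = Equivalence.to (enum-spec n t) t∈ in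
      trees-complete n L t (NP.≤-reflexive (length-suc-upTo n)) (sorted-suc-upTo n) t↭ t-inc
    sound : ∀ {t} → t ∈ trees n L → t ∈ enum n
    sound {t} t∈ = Equivalence.from (enum-spec n t) (trees-sound n L (sorted-suc-upTo n) t∈)

  sumMap-enum : ∀ w → LabelIndependent w → ∀ n → sumMap w (enum n) ≡ treeSum w n
  sumMap-enum w w-ind n = begin
    sumMap w (enum n)                          ≡⟨ sumMap-↭ w (enum↭trees n) ⟩
    sumMap w (trees n (map suc (upTo n)))      ≡⟨ trees-sum w w-ind n (map suc (upTo n)) (NP.≤-reflexive (length-suc-upTo n)) ⟩
    treeSum w (length (map suc (upTo n)))      ≡⟨ cong (treeSum w) (length-suc-upTo n) ⟩
    treeSum w n                                ∎

-- Ranks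

mutual
  rank-relabel : ∀ h t → rank (relabel h t) ≡ rank t
  rank-relabel h (node x []) = refl
  rank-relabel h (node x (c ∷ cs)) =
    cong suc (trans (minRank-relabel h (rank (relabel h c)) cs) (cong (λ m → minRank m cs) (rank-relabel h c)))

  minRank-relabel : ∀ h m cs → minRank m (relabelF h cs) ≡ minRank m cs
  minRank-relabel h m [] = refl
  minRank-relabel h m (c ∷ cs) =
    trans (minRank-relabel h (m N.⊓ rank (relabel h c)) cs) (cong (λ r → minRank (m N.⊓ r) cs) (rank-relabel h c))

mutual
  countRank-relabel : ∀ h k t → countRank k (relabel h t) ≡ countRank k t
  countRank-relabel h k (node x cs) =
    cong₂ N._+_ (cong (λ r → ind ⌊ r ≟ k ⌋) (rank-relabel h (node x cs))) (countRankF-relabel h k cs)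

  countRankF-relabel : ∀ h k cs → countRankF k (relabelF h cs) ≡ countRankF k cs
  countRankF-relabel h k [] = refl
  countRankF-relabel h k (c ∷ cs) = cong₂ N._+_ (countRank-relabel h k c) (countRankF-relabel h k cs)

rank≥ : ℕ → PTree → ℕ
rank≥ k t = ind ⌊ k ≤? rank t ⌋

rank≡ : ℕ → PTree → ℕ
rank≡ k t = ind ⌊ rank t ≟ k ⌋

allRank≥ : ℕ → List PTree → ℕ
allRank≥ k [] = 1
allRank≥ k (c ∷ cs) = rank≥ k c N.* allRank≥ k cs

rank≥-independent : ∀ k → LabelIndependent (rank≥ k)
rank≥-independent k t = cong (λ r → ind ⌊ k ≤? r ⌋) (rank-relabel _ t)

rank≡-independent : ∀ k → LabelIndependent (rank≡ k)
rank≡-independent k t = cong (λ r → ind ⌊ r ≟ k ⌋) (rank-relabel _ t)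

allRank≥-independent : ∀ k → LabelIndependentF (allRank≥ k)
allRank≥-independent k [] = refl
allRank≥-independent k (c ∷ cs) = cong₂ N._*_ (rank≥-independent k c) (allRank≥-independent k cs)

ind-true : ∀ {P : Set} (P? : Dec P) → P → ind ⌊ P? ⌋ ≡ 1
ind-true (yes _) _ = refl
ind-true (no ¬p) p = ⊥-elim (¬p p)

ind-false : ∀ {P : Set} (P? : Dec P) → ¬ P → ind ⌊ P? ⌋ ≡ 0
ind-false (yes p) ¬p = ⊥-elim (¬p p)
ind-false (no _) _ = refl

ind-≤-⊓ : ∀ j a b → ind ⌊ j ≤? a N.⊓ b ⌋ ≡ ind ⌊ j ≤? a ⌋ N.* ind ⌊ j ≤? b ⌋
ind-≤-⊓ j a b with j ≤? a | j ≤? b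
... | yes j≤a | yes j≤b = ind-true (j ≤? a N.⊓ b) (NP.⊓-glb j≤a j≤b)
... | yes _ | no j≰b = ind-false (j ≤? a N.⊓ b) (λ j≤ → j≰b (NP.≤-trans j≤ (NP.m⊓n≤n a b)))
... | no j≰a | _ = ind-false (j ≤? a N.⊓ b) (λ j≤ → j≰a (NP.≤-trans j≤ (NP.m⊓n≤m a b)))

ind-≤?-suc : ∀ a b → ind ⌊ suc a ≤? suc b ⌋ ≡ ind ⌊ a ≤? b ⌋
ind-≤?-suc a b with a ≤? b
... | yes a≤b = ind-true (suc a ≤? suc b) (s≤s a≤b)
... | no a≰b = ind-false (suc a ≤? suc b) (a≰b ∘ NP.≤-pred)

ind-≤-minRank : ∀ j m cs → ind ⌊ j ≤? minRank m cs ⌋ ≡ ind ⌊ j ≤? m ⌋ N.* allRank≥ j cs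
ind-≤-minRank j m [] = sym (NP.*-identityʳ _)
ind-≤-minRank j m (c ∷ cs) = begin
  ind ⌊ j ≤? minRank (m N.⊓ rank c) cs ⌋
    ≡⟨ ind-≤-minRank j (m N.⊓ rank c) cs ⟩
  ind ⌊ j ≤? m N.⊓ rank c ⌋ N.* allRank≥ j cs
    ≡⟨ cong (N._* allRank≥ j cs) (ind-≤-⊓ j m (rank c)) ⟩
  ind ⌊ j ≤? m ⌋ N.* rank≥ j c N.* allRank≥ j cs
    ≡⟨ NP.*-assoc (ind ⌊ j ≤? m ⌋) (rank≥ j c) (allRank≥ j cs) ⟩
  ind ⌊ j ≤? m ⌋ N.* allRank≥ j (c ∷ cs) ∎

rank≥-suc-node : ∀ j x c cs → rank≥ (suc j) (node x (c ∷ cs)) ≡ rank≥ j c N.* allRank≥ j cs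
rank≥-suc-node j x c cs = begin
  ind ⌊ suc j ≤? suc (minRank (rank c) cs) ⌋       ≡⟨ ind-≤?-suc j (minRank (rank c) cs) ⟩
  ind ⌊ j ≤? minRank (rank c) cs ⌋                 ≡⟨ ind-≤-minRank j (rank c) cs ⟩
  rank≥ j c N.* allRank≥ j cs                      ∎

ind-≟+ind-suc≤ : ∀ k r → ind ⌊ r ≟ k ⌋ N.+ ind ⌊ suc k ≤? r ⌋ ≡ ind ⌊ k ≤? r ⌋
ind-≟+ind-suc≤ k r with k ≤? r
... | no k≰r = cong₂ N._+_ (ind-false (r ≟ k) (λ r≡k → k≰r (NP.≤-reflexive (sym r≡k))))
                          (ind-false (suc k ≤? r) (k≰r ∘ NP.<⇒≤))
... | yes k≤r with r ≟ k
...   | yes r≡k = cong suc (ind-false (suc k ≤? r) (NP.<-irrefl (sym r≡k)))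
...   | no r≢k = ind-true (suc k ≤? r) (NP.≤∧≢⇒< k≤r (r≢k ∘ sym))

rank≡+rank≥suc : ∀ k t → rank≡ k t N.+ rank≥ (suc k) t ≡ rank≥ k t
rank≡+rank≥suc k t = ind-≟+ind-suc≤ k (rank t)

module RankCounts (enum : ℕ → List PTree) (enum-spec : ∀ n t → (t ∈ enum n) ⇔ IsPIT n t)
                  (enum-unique : ∀ n → Unique (enum n)) where

  open Counts enum
  open Enumeration enum enum-spec enum-unique

  bgeS≗treeS : ∀ k → bgeS k ≗ treeS (rank≥ k)
  bgeS≗treeS k zero = refl
  bgeS≗treeS k (suc m) = cong +_ (trans (length-filter (λ t → k ≤? rank t) (enum (suc m)))
                                        (sumMap-enum (rank≥ k) (rank≥-independent k) (suc m)))

  bS≗treeS : ∀ k → bS k ≗ treeS (rank≡ k)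
  bS≗treeS k zero = refl
  bS≗treeS k (suc m) = cong +_ (trans (length-filter (λ t → rank t ≟ k) (enum (suc m)))
                                      (sumMap-enum (rank≡ k) (rank≡-independent k) (suc m)))

  aS≗treeS : ∀ k → aS k ≗ treeS (countRank k)
  aS≗treeS k zero = refl
  aS≗treeS k (suc m) = cong +_ (sumMap-enum (countRank k) (countRank-relabel _ k) (suc m))

  bgeS-0 : bgeS 0 ≗ tS
  bgeS-0 n = trans (bgeS≗treeS 0 n) (treeS-count n)

  bS-difference : ∀ k → bS k ≗ bgeS k ⊕ negS (bgeS (suc k))
  bS-difference k zero = refl
  bS-difference k (suc m) = begin
    + a                  ≡⟨ add-and-subtract (+ a) (+ b) ⟩
    + a + + b - + b      ≡⟨ cong (_- + b) (ZP.pos-+ a b) ⟨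
    + (a N.+ b) - + b    ≡⟨ cong (λ z → + z - + b) a+b≡c ⟩
    + c - + b            ∎
    where
    trees-m : List PTree
    trees-m = enum (suc m)
    a b c : ℕ
    a = length (filter (λ t → rank t ≟ k) trees-m)
    b = length (filter (λ t → suc k ≤? rank t) trees-m)
    c = length (filter (λ t → k ≤? rank t) trees-m)
    add-and-subtract : ∀ x y → x ≡ x + y - y
    add-and-subtract = solve-∀
    a+b≡c : a N.+ b ≡ c
    a+b≡c = begin
      a N.+ b
        ≡⟨ cong₂ N._+_ (length-filter (λ t → rank t ≟ k) trees-m) (length-filter (λ t → suc k ≤? rank t) trees-m) ⟩
      sumMap (rank≡ k) trees-m N.+ sumMap (rank≥ (suc k)) trees-m
        ≡⟨ sumMap-+ (rank≡ k) (rank≥ (suc k)) trees-m ⟨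
      sumMap (λ t → rank≡ k t N.+ rank≥ (suc k) t) trees-m
        ≡⟨ sumMap-cong (rank≡+rank≥suc k) trees-m ⟩
      sumMap (rank≥ k) trees-m
        ≡⟨ length-filter (λ t → k ≤? rank t) trees-m ⟨
      c ∎

  D-bgeS-suc : ∀ j → D (bgeS (suc j)) ≗ bgeS j ⋆ inv1m (bgeS j)
  D-bgeS-suc j n = begin
    bgeS (suc j) (suc n)
      ≡⟨ bgeS≗treeS (suc j) (suc n) ⟩
    forestS (rank≥ (suc j) ∘ node 0) n
      ≡⟨ forestS-cons₁ (rank≥ (suc j) ∘ node 0) (rank≥ j) (allRank≥ j) (rank≥-independent j)
                       (allRank≥-independent j) (rank≥-suc-node j 0) n ⟩
    constS 0 n + (T ⋆ forestS (allRank≥ j)) n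
      ≡⟨ cong₂ _+_ (constS-0 n) (⋆-congˡ T subtrees n) ⟩
    0ℤ + (T ⋆ inv1m T) n
      ≡⟨ ZP.+-identityˡ ((T ⋆ inv1m T) n) ⟩
    (T ⋆ inv1m T) n
      ≡⟨ ⋆-cong T≗bgeS (inv1m-cong T≗bgeS) n ⟩
    (bgeS j ⋆ inv1m (bgeS j)) n ∎
    where
    T : Series
    T = treeS (rank≥ j)
    T≗bgeS : T ≗ bgeS j
    T≗bgeS = sym ∘ bgeS≗treeS j
    subtrees : forestS (allRank≥ j) ≗ inv1m T
    subtrees = forestS-product (rank≥ j) (allRank≥ j) (rank≥-independent j) (allRank≥-independent j) refl (λ _ _ → refl)

  D-aS : ∀ k → D (aS k) ≗ aS k ⋆ (inv1m tS ⋆ inv1m tS) ⊕ D (bS k)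
  D-aS k n = begin
    aS k (suc n)
      ≡⟨ aS≗treeS k (suc n) ⟩
    + forestSum (countRank k ∘ node 0) n
      ≡⟨ cong +_ (sumMap-+ (rank≡ k ∘ node 0) (countRankF k) (forests (suc n) (replicate n 0))) ⟩
    + (forestSum (rank≡ k ∘ node 0) n N.+ forestSum (countRankF k) n)
      ≡⟨ ZP.pos-+ (forestSum (rank≡ k ∘ node 0) n) (forestSum (countRankF k) n) ⟩
    treeS (rank≡ k) (suc n) + forestS (countRankF k) n
      ≡⟨ cong₂ _+_ (sym (bS≗treeS k (suc n))) (⋆-fixpoint-inv1m² (aS k) tS refl subforest-eq n) ⟩
    bS k (suc n) + (aS k ⋆ (inv1m tS ⋆ inv1m tS)) n
      ≡⟨ ZP.+-comm (bS k (suc n)) ((aS k ⋆ (inv1m tS ⋆ inv1m tS)) n) ⟩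
    (aS k ⋆ (inv1m tS ⋆ inv1m tS)) n + bS k (suc n) ∎
    where
    F : Series
    F = forestS (countRankF k)
    split : ∀ c cs → countRankF k (c ∷ cs) ≡ countRank k c N.* 1 N.+ 1 N.* countRankF k cs
    split c cs = sym (cong₂ N._+_ (NP.*-identityʳ (countRank k c)) (NP.*-identityˡ (countRankF k cs)))
    subforest-eq : F ≗ aS k ⋆ inv1m tS ⊕ tS ⋆ F
    subforest-eq zero = refl
    subforest-eq (suc m) = begin
      F (suc m)
        ≡⟨ forestS-cons (countRankF k) (countRank k) (λ _ → 1) (λ _ → 1) (countRankF k)
                        (countRank-relabel _ k) (λ _ → refl) (λ _ → refl) (countRankF-relabel _ k) split m ⟩
      (treeS (countRank k) ⋆ forestS (λ _ → 1)) (suc m) + (treeS (λ _ → 1) ⋆ F) (suc m)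
        ≡⟨ cong₂ _+_ (⋆-cong (sym ∘ aS≗treeS k) (λ i → trans (forestS-count i) (inv1m-cong treeS-count i)) (suc m))
                     (⋆-congʳ F treeS-count (suc m)) ⟩
      (aS k ⋆ inv1m tS) (suc m) + (tS ⋆ F) (suc m) ∎

proposition2p2 : (enum : ℕ → List PTree)
    → (∀ n t → (t ∈ enum n) ⇔ IsPIT n t)
    → (∀ n → Unique (enum n))
    → let open Counts enum in
      (∀ k → (∀ n → D (aS k) n ≡ ((aS k ⋆ (inv1m tS ⋆ inv1m tS)) n + D (bS k) n))
           × (∀ n → bS k n ≡ bgeS k n - bgeS (suc k) n))
      × (∀ k → 1 ≤ k → ∀ n → D (bgeS k) n ≡ (bgeS (k ∸ 1) ⋆ inv1m (bgeS (k ∸ 1))) n)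
      × (∀ n → bgeS 0 n ≡ tS n)
proposition2p2 enum enum-spec enum-unique =
  (λ k → D-aS k , bS-difference k) , (λ { (suc j) _ → D-bgeS-suc j }) , bgeS-0
  where
  open RankCounts enum enum-spec enum-unique
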